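{- Let $A\in S^{N\times k}$ be an $N\times k$ array with entries in a set $S$ of size $s$, let $\lambda=N/s^2$, $\gamma=(\lambda s-1)k/(\lambda s^2-1)$ and $$L=\lambda s^2(\lambda s^2-1)\left(\binom{\lfloor\gamma\rfloor}{2}+\lfloor\gamma\rfloor(\gamma-\lfloor\gamma\rfloor)\right)-\lambda(\lambda-1)s^2\binom{k}{2}.$$ (i) If $\lambda=1$ and $k=\alpha(s+1)+\tilde{\kappa}$ with $\alpha$ a nonnegative integer and $0\leq\tilde{\kappa}\leq s$, then $L=\alpha\tilde{\kappa}s^2(s-1)+\binom{\alpha}{2}s^2(s^2-1)$ and $$\mathrm{Unb}_{2,2}(A)\geq \alpha\tilde{\kappa} s^2(s-1)+\binom{\alpha}{2}s^2(s^2-1),$$ which equals $0$ if $\alpha=0$ and $\tilde{\kappa}s^2(s-1)$ if $\alpha=1$. (ii) If $\lambda=2$ and $k=2s+1+\tilde{\kappa}$ with $1\leq\tilde{\kappa}\leq s$, then $L=2s^2\left((2\tilde{\kappa}-1)(s-1)-\binom{\tilde{\kappa}+1}{2}\right)$ and $$\mathrm{Unb}_{2,2}(A)\geq 2s^2\left((2\tilde{\kappa}-1)(s-1)-\binom{\tilde{\kappa}+1}{2}\right).$$ (iii) If $\lambda=2$ and $2\leq k\leq 2s+1$, then $L<0$.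
   Context: For $x\in S^2$ and $j=(j_1,j_2)$ with $1\leq j_1<j_2\leq k$, let $n(A,x,j)=\#\{i\in[N]: A_{i,j_1}=x_1,\ A_{i,j_2}=x_2\}$. The $2$-unbalance of strength $2$ is $\mathrm{Unb}_{2,2}(A)=\sum_{x\in S^2}\sum_{1\leq j_1<j_2\leq k}|n(A,x,(j_1,j_2))-N/s^2|^2$. $\binom{m}{2}=m(m-1)/2$ for integers $m\geq 0$. -}

module Defs where

open import Data.Nat as ℕ using (ℕ; zero; suc)
open import Data.Integer as ℤ using (ℤ; +_)
open import Data.Rational as ℚ using (ℚ; 0ℚ; 1ℚ; _÷_; floor; ≢-nonZero)
open import Data.Rational.Properties using (_≟_)
open import Data.Fin using (Fin; toℕ)
open import Data.Fin.Properties as FinP using ()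
open import Data.Product using (_×_; _,_)
open import Data.List using (List; length; filter; map; foldr; concatMap; allFin)
open import Data.Product.Nary.NonDependent using ()
open import Relation.Nullary using (yes; no; _×-dec_)
import Data.Nat.Properties as ℕP

ι : ℕ → ℚ
ι n = + n ℚ./ 1

ιℤ : ℤ → ℚ
ιℤ z = z ℚ./ 1

-- Total division on ℚ (returns 0 when the divisor is 0); only ever used
-- under hypotheses guaranteeing a nonzero divisor.
_÷'_ : ℚ → ℚ → ℚ
p ÷' q with q ≟ 0ℚ
... | yes _  = 0ℚ
... | no q≢0 = _÷_ p q {{≢-nonZero q≢0}}

choose2 : ℤ → ℚ
choose2 m = (ιℤ m ℚ.* (ιℤ m ℚ.- 1ℚ)) ÷' ι 2

sumℚ : List ℚ → ℚ
sumℚ = foldr ℚ._+_ 0ℚ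

Array : ℕ → ℕ → ℕ → Set
Array N k s = Fin N → Fin k → Fin s

count : ∀ {N k s} → Array N k s → Fin s × Fin s → Fin k × Fin k → ℕ
count {N} A (x₁ , x₂) (j₁ , j₂) =
  length (filter (λ i → (A i j₁ FinP.≟ x₁) ×-dec (A i j₂ FinP.≟ x₂)) (allFin N))

pairs< : (k : ℕ) → List (Fin k × Fin k)
pairs< k = filter (λ p → toℕ (Data.Product.proj₁ p) ℕP.<? toℕ (Data.Product.proj₂ p))
                  (concatMap (λ a → map (λ b → (a , b)) (allFin k)) (allFin k))
  where import Data.Product

points : (s : ℕ) → List (Fin s × Fin s)
points s = concatMap (λ a → map (λ b → (a , b)) (allFin s)) (allFin s)

lam : (s N : ℕ) → ℚ
lam s N = ι N ÷' ι (s ℕ.* s)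

Unb22 : ∀ {N k s} → Array N k s → ℚ
Unb22 {N} {k} {s} A =
  sumℚ (map (λ x → sumℚ (map (λ j →
      let d = ι (count A x j) ℚ.- lam s N in d ℚ.* d) (pairs< k))) (points s))

gam : (s N k : ℕ) → ℚ
gam s N k = ((lam s N ℚ.* ι s ℚ.- 1ℚ) ℚ.* ι k)
            ÷' (lam s N ℚ.* ι (s ℕ.* s) ℚ.- 1ℚ)

Lbound : (s N k : ℕ) → ℚ
Lbound s N k =
  let λ' = lam s N
      γ  = gam s N k
      fγ = floor γ
      ls2 = λ' ℚ.* ι (s ℕ.* s)
  in (ls2 ℚ.* (ls2 ℚ.- 1ℚ)) ℚ.* (choose2 fγ ℚ.+ ιℤ fγ ℚ.* (γ ℚ.- ιℤ fγ))
     ℚ.- ((λ' ℚ.* (λ' ℚ.- 1ℚ)) ℚ.* ι (s ℕ.* s)) ℚ.* choose2 (+ k)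

{-# OPTIONS --safe #-}
module Submission where

-- Let c(i,i′) be the number of columns in which rows i and i′ of A agree and m(j,a) the number
-- of occurrences of a in column j. Double counting gives
--   2 Unb(A) = Σ_{i,i′} (c² − c) + (k² − k)(s²λ² − 2λN)   and   Σ_{i,i′} c = Σ_{j,a} m(j,a)²,
-- and Σ_a m(j,a)² ≥ N²/s since Σ_a m(j,a) = N. For any integer g ≥ 0,
-- c² − c = (c − g)(c − g − 1) + 2gc − g(g + 1), where (c − g)(c − g − 1) is a product of
-- consecutive integers, hence ≥ 0, and equals (k − g)(k − g − 1) on the diagonal i = i′.
-- For integral λ this yields Unb(A) ≥ L_g, a quadratic polynomial in g, and L_g = L for every
-- integer g ∈ [γ − 1, γ] (in particular for g = ⌊γ⌋) because the interpolation of C(·,2) is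
-- continuous. Parts (i) and (ii) evaluate L_g at g = α and g = 2; for (iii), ⌊γ⌋ ∈ {0, 1, 2}
-- and L_g < 0 for each of these.

open import Defs
open import Algebra.Bundles.Raw using (RawRing)
open import Data.Bool.Base using (true; false; if_then_else_)
open import Data.Empty using (⊥-elim)
open import Data.Fin.Base as Fin using (Fin; toℕ)
import Data.Fin.Properties as Fin
open import Data.Integer.Base as ℤ using (ℤ; +_; -[1+_]; 0ℤ; 1ℤ)
import Data.Integer.DivMod as ℤ
import Data.Integer.GCD as ℤ
import Data.Integer.Properties as ℤ
import Data.Integer.Solver
open import Data.Integer.Tactic.RingSolver using (solve-∀)
open import Data.List.Base using (List; []; _∷_; _++_; map; concatMap; filter; length; allFin)
import Data.List.Properties as List
open import Data.List.Membership.Propositional using (_∈_)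
open import Data.List.Relation.Unary.Any using (here; there)
open import Data.Nat.Base as ℕ using (ℕ; zero; suc)
import Data.Nat.Properties as ℕ
open import Data.Product.Base using (_×_; _,_; proj₁; proj₂)
open import Data.Rational.Base as ℚ using (ℚ; mkℚ; 0ℚ; 1ℚ; ½; ↥_; ↧_; *≤*; *<*; floor)
import Data.Rational.Properties as ℚ
import Data.Rational.Solver
open import Data.Rational.Unnormalised.Base as ℚᵘ using (mkℚᵘ; *≡*)
import Data.Rational.Unnormalised.Properties as ℚᵘ
open import Function.Base using (id; _∘_)
open import Level using (0ℓ)
open import Relation.Binary.Definitions using (tri<; tri≈; tri>)
open import Relation.Binary.PropositionalEquality
open import Relation.Nullary.Decidable using (Dec; yes; no; does; dec-true; dec-false; _×-dec_)
open import Relation.Nullary.Negation using (¬_)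

module ℤ-Solver = Data.Integer.Solver.+-*-Solver
module ℚ-Solver = Data.Rational.Solver.+-*-Solver

module RationalEmbedding where

  ↥ιℤ : ∀ z → ↥ ιℤ z ≡ z
  ↥ιℤ z = trans (sym (ℤ.*-identityʳ _)) (trans (cong (↥ ιℤ z ℤ.*_) (sym (ℤ.gcd-zeroʳ z))) (ℚ.↥-/ z 1))

  ↧ιℤ : ∀ z → ↧ ιℤ z ≡ 1ℤ
  ↧ιℤ z = trans (sym (ℤ.*-identityʳ _)) (trans (cong (↧ ιℤ z ℤ.*_) (sym (ℤ.gcd-zeroʳ z))) (ℚ.↧-/ z 1))

  ↥ιℤ*↧ιℤ : ∀ a b → ↥ ιℤ a ℤ.* ↧ ιℤ b ≡ a
  ↥ιℤ*↧ιℤ a b = trans (cong₂ ℤ._*_ (↥ιℤ a) (↧ιℤ b)) (ℤ.*-identityʳ a)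

  ιℤ-mono-≤ : ∀ {a b} → a ℤ.≤ b → ιℤ a ℚ.≤ ιℤ b
  ιℤ-mono-≤ {a} {b} a≤b = *≤* (subst₂ ℤ._≤_ (sym (↥ιℤ*↧ιℤ a b)) (sym (↥ιℤ*↧ιℤ b a)) a≤b)

  ιℤ-mono-< : ∀ {a b} → a ℤ.< b → ιℤ a ℚ.< ιℤ b
  ιℤ-mono-< {a} {b} a<b = *<* (subst₂ ℤ._<_ (sym (↥ιℤ*↧ιℤ a b)) (sym (↥ιℤ*↧ιℤ b a)) a<b)

  ιℤ-cancel-< : ∀ {a b} → ιℤ a ℚ.< ιℤ b → a ℤ.< b
  ιℤ-cancel-< {a} {b} (*<* a<b) = subst₂ ℤ._<_ (↥ιℤ*↧ιℤ a b) (↥ιℤ*↧ιℤ b a) a<b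

  ιℤ-injective : ∀ {a b} → ιℤ a ≡ ιℤ b → a ≡ b
  ιℤ-injective {a} {b} eq = trans (sym (↥ιℤ a)) (trans (cong ↥_ eq) (↥ιℤ b))

  private
    toℚᵘ-ιℤ : ∀ a → ℚ.toℚᵘ (ιℤ a) ℚᵘ.≃ mkℚᵘ a 0
    toℚᵘ-ιℤ a = *≡* (trans (cong (ℤ._* 1ℤ) (trans (ℚ.↥ᵘ-toℚᵘ (ιℤ a)) (↥ιℤ a)))
                     (cong (a ℤ.*_) (sym (trans (ℚ.↧ᵘ-toℚᵘ (ιℤ a)) (↧ιℤ a)))))

    -- On ℚᵘ the embedding a ↦ a/1 is a homomorphism on the nose.
    via-ℚᵘ : ∀ c {p} → mkℚᵘ c 0 ℚᵘ.≃ ℚ.toℚᵘ p → ιℤ c ≡ p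
    via-ℚᵘ _ c≃p = ℚ.toℚᵘ-injective (ℚᵘ.≃-trans (toℚᵘ-ιℤ _) c≃p)

  ιℤ-+ : ∀ a b → ιℤ (a ℤ.+ b) ≡ ιℤ a ℚ.+ ιℤ b
  ιℤ-+ a b = via-ℚᵘ (a ℤ.+ b) (ℚᵘ.≃-sym (ℚᵘ.≃-trans (ℚ.toℚᵘ-homo-+ (ιℤ a) (ιℤ b))
    (ℚᵘ.≃-trans (ℚᵘ.+-cong (toℚᵘ-ιℤ a) (toℚᵘ-ιℤ b))
      (*≡* (cong₂ (λ x y → (x ℤ.+ y) ℤ.* 1ℤ) (ℤ.*-identityʳ a) (ℤ.*-identityʳ b))))))

  ιℤ-* : ∀ a b → ιℤ (a ℤ.* b) ≡ ιℤ a ℚ.* ιℤ b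
  ιℤ-* a b = via-ℚᵘ (a ℤ.* b) (ℚᵘ.≃-sym (ℚᵘ.≃-trans (ℚ.toℚᵘ-homo-* (ιℤ a) (ιℤ b))
    (ℚᵘ.≃-trans (ℚᵘ.*-cong (toℚᵘ-ιℤ a) (toℚᵘ-ιℤ b)) (*≡* refl))))

  ιℤ-neg : ∀ a → ιℤ (ℤ.- a) ≡ ℚ.- ιℤ a
  ιℤ-neg a = via-ℚᵘ (ℤ.- a) (ℚᵘ.≃-sym (ℚᵘ.≃-trans (ℚ.toℚᵘ-homo‿- (ιℤ a)) (ℚᵘ.-‿cong (toℚᵘ-ιℤ a))))

  ι-* : ∀ m n → ι (m ℕ.* n) ≡ ι m ℚ.* ι n
  ι-* m n = trans (cong ιℤ (ℤ.pos-* m n)) (ιℤ-* (+ m) (+ n))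


module Floor where

  open RationalEmbedding

  floor-≤ : ∀ p → ιℤ (floor p) ℚ.≤ p
  floor-≤ p@(mkℚ n d _) = *≤* (subst₂ ℤ._≤_
    (cong (ℤ._* + suc d) (sym (↥ιℤ (floor p))))
    (sym (trans (cong (n ℤ.*_) (↧ιℤ (floor p))) (ℤ.*-identityʳ n)))
    (ℤ.[n/d]*d≤n n (+ suc d)))

  <-suc-floor : ∀ p → p ℚ.< ιℤ (ℤ.suc (floor p))
  <-suc-floor p@(mkℚ n d _) = *<* (subst₂ ℤ._<_
    (sym (trans (cong (n ℤ.*_) (↧ιℤ (ℤ.suc (floor p)))) (ℤ.*-identityʳ n)))
    (cong (ℤ._* + suc d) (sym (↥ιℤ (ℤ.suc (floor p)))))
    (subst (λ q → n ℤ.< ℤ.suc q ℤ.* + suc d) (sym (ℤ.div-pos-is-/ℕ n (suc d))) (ℤ.n<s[n/ℕd]*d n (suc d))))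

  private
    <-suc⇒≤ : ∀ {a b} → a ℤ.< ℤ.suc b → a ℤ.≤ b
    <-suc⇒≤ {b = b} a<suc[b] = subst (_ ℤ.≤_) (ℤ.pred-suc b) (ℤ.i<j⇒i≤pred[j] a<suc[b])

  floor-greatest : ∀ {z p} → ιℤ z ℚ.≤ p → z ℤ.≤ floor p
  floor-greatest {z} {p} z≤p = <-suc⇒≤ (ιℤ-cancel-< (ℚ.≤-<-trans z≤p (<-suc-floor p)))

  floor-unique : ∀ {z p} → ιℤ z ℚ.≤ p → p ℚ.< ιℤ (ℤ.suc z) → floor p ≡ z
  floor-unique {z} {p} z≤p p<suc[z] = ℤ.≤-antisym
    (<-suc⇒≤ (ιℤ-cancel-< (ℚ.≤-<-trans (floor-≤ p) p<suc[z])))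
    (floor-greatest z≤p)

module TotalDivision where

  ÷′-*-cancel : ∀ p q → q ≢ 0ℚ → (p ÷' q) ℚ.* q ≡ p
  ÷′-*-cancel p q q≢0 with q ℚ.≟ 0ℚ
  ... | yes q≡0 = ⊥-elim (q≢0 q≡0)
  ... | no q≢0′ = trans (ℚ.*-assoc p _ q) (trans (cong (p ℚ.*_) (ℚ.*-inverseˡ q {{ℚ.≢-nonZero q≢0′}})) (ℚ.*-identityʳ p))

  module _ {p q : ℚ} (0<q : 0ℚ ℚ.< q) where

    private
      instance
        q-positive : ℚ.Positive q
        q-positive = ℚ.positive 0<q
        q-nonNegative : ℚ.NonNegative q
        q-nonNegative = ℚ.nonNegative (ℚ.<⇒≤ 0<q)

      [p÷q]*q≡p : (p ÷' q) ℚ.* q ≡ p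
      [p÷q]*q≡p = ÷′-*-cancel p q (λ q≡0 → ℚ.<-irrefl (sym q≡0) 0<q)

    ≤-÷′ : ∀ {a} → a ℚ.* q ℚ.≤ p → a ℚ.≤ p ÷' q
    ≤-÷′ aq≤p = ℚ.*-cancelʳ-≤-pos q (subst (_ ℚ.≤_) (sym [p÷q]*q≡p) aq≤p)

    ÷′-≤ : ∀ {a} → p ℚ.≤ a ℚ.* q → p ÷' q ℚ.≤ a
    ÷′-≤ p≤aq = ℚ.*-cancelʳ-≤-pos q (subst (ℚ._≤ _) (sym [p÷q]*q≡p) p≤aq)

    ÷′-< : ∀ {a} → p ℚ.< a ℚ.* q → p ÷' q ℚ.< a
    ÷′-< p<aq = ℚ.*-cancelʳ-<-nonNeg q (subst (ℚ._< _) (sym [p÷q]*q≡p) p<aq)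

module IntegerOrder where

  open import Data.Integer.Base using (_+_; _*_; _-_; -_; _≤_; _<_)

  square-nonNeg : ∀ z → 0ℤ ≤ z * z
  square-nonNeg (+ n)    = subst (0ℤ ≤_) (ℤ.pos-* n n) (ℤ.+≤+ ℕ.z≤n)
  square-nonNeg -[1+ n ] = ℤ.+≤+ ℕ.z≤n

  consecutive-product-nonNeg : ∀ z → 0ℤ ≤ z * (z - 1ℤ)
  consecutive-product-nonNeg (+ zero)  = ℤ.≤-refl
  consecutive-product-nonNeg (+ suc n) = subst (0ℤ ≤_) (ℤ.pos-* (suc n) n) (ℤ.+≤+ ℕ.z≤n)
  consecutive-product-nonNeg -[1+ n ]  = ℤ.+≤+ ℕ.z≤n

  *-nonNeg : ∀ {a b} → 0ℤ ≤ a → 0ℤ ≤ b → 0ℤ ≤ a * b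
  *-nonNeg {a} {b} 0≤a 0≤b = subst (_≤ a * b) (ℤ.*-zeroʳ a) (ℤ.*-monoˡ-≤-nonNeg a {{ℤ.nonNegative 0≤a}} 0≤b)

  *-pos : ∀ {a b} → 0ℤ < a → 0ℤ < b → 0ℤ < a * b
  *-pos {a} {b} 0<a 0<b = subst (_< a * b) (ℤ.*-zeroʳ a) (ℤ.*-monoˡ-<-pos a {{ℤ.positive 0<a}} 0<b)

  ≤-by-difference : ∀ {a b} d → b - a ≡ d → 0ℤ ≤ d → a ≤ b
  ≤-by-difference d b-a≡d 0≤d = ℤ.0≤i-j⇒j≤i (subst (0ℤ ≤_) (sym b-a≡d) 0≤d)

  <-by-difference : ∀ {a b} d → b - a ≡ d → 0ℤ < d → a < b
  <-by-difference {a} {b} d b-a≡d 0<d =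
    subst₂ _<_ (ℤ.+-identityˡ a) (cancel b a) (ℤ.+-monoˡ-< a (subst (0ℤ <_) (sym b-a≡d) 0<d))
    where cancel : ∀ b a → b - a + a ≡ b
          cancel = solve-∀

  0<j-i : ∀ {i j} → i < j → 0ℤ < j - i
  0<j-i {i} {j} i<j = subst (_< j - i) (ℤ.+-inverseʳ i) (ℤ.+-monoˡ-< (- i) i<j)

module ListSums where

  open import Data.Integer.Base using (_+_; _*_; _-_; -_; _≤_)

  ∑ : {A : Set} → List A → (A → ℤ) → ℤ
  ∑ []       f = 0ℤ
  ∑ (x ∷ xs) f = f x + ∑ xs f

  syntax ∑ xs (λ x → e) = ∑[ x ∈ xs ] e

  𝟙 : ∀ {p} {P : Set p} → Dec P → ℤ
  𝟙 P? = if does P? then 1ℤ else 0ℤ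

  𝟙-true : ∀ {p} {P : Set p} (P? : Dec P) → P → 𝟙 P? ≡ 1ℤ
  𝟙-true P? p rewrite dec-true P? p = refl

  𝟙-false : ∀ {p} {P : Set p} (P? : Dec P) → ¬ P → 𝟙 P? ≡ 0ℤ
  𝟙-false P? ¬p rewrite dec-false P? ¬p = refl

  𝟙-× : ∀ {p q} {P : Set p} {Q : Set q} (P? : Dec P) (Q? : Dec Q) → 𝟙 (P? ×-dec Q?) ≡ 𝟙 P? * 𝟙 Q?
  𝟙-× P? Q? with does P? | does Q?
  ... | true  | true  = refl
  ... | true  | false = refl
  ... | false | _     = refl

  𝟙-idem : ∀ {p} {P : Set p} (P? : Dec P) → 𝟙 P? * 𝟙 P? ≡ 𝟙 P?
  𝟙-idem P? with does P?
  ... | true  = refl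
  ... | false = refl

  module _ {A : Set} where

    ∑-cong : ∀ xs {f g : A → ℤ} → (∀ x → f x ≡ g x) → ∑ xs f ≡ ∑ xs g
    ∑-cong []       f≗g = refl
    ∑-cong (x ∷ xs) f≗g = cong₂ _+_ (f≗g x) (∑-cong xs f≗g)

    ∑-distrib-+ : ∀ xs (f g : A → ℤ) → ∑[ x ∈ xs ] (f x + g x) ≡ ∑ xs f + ∑ xs g
    ∑-distrib-+ []       f g = refl
    ∑-distrib-+ (x ∷ xs) f g = trans (cong (_+_ (f x + g x)) (∑-distrib-+ xs f g)) (swap (f x) (g x) (∑ xs f) (∑ xs g))
      where
      swap : ∀ a b c d → a + b + (c + d) ≡ a + c + (b + d)
      swap = solve-∀

    ∑-distrib-− : ∀ xs (f g : A → ℤ) → ∑[ x ∈ xs ] (f x - g x) ≡ ∑ xs f - ∑ xs g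
    ∑-distrib-− []       f g = refl
    ∑-distrib-− (x ∷ xs) f g = trans (cong (_+_ (f x - g x)) (∑-distrib-− xs f g)) (regroup (f x) (g x) (∑ xs f) (∑ xs g))
      where
      regroup : ∀ a b c d → a - b + (c - d) ≡ a + c - (b + d)
      regroup = solve-∀

    ∑-*ˡ : ∀ xs c (f : A → ℤ) → ∑[ x ∈ xs ] (c * f x) ≡ c * ∑ xs f
    ∑-*ˡ []       c f = sym (ℤ.*-zeroʳ c)
    ∑-*ˡ (x ∷ xs) c f = trans (cong (_+_ (c * f x)) (∑-*ˡ xs c f)) (sym (ℤ.*-distribˡ-+ c (f x) (∑ xs f)))

    ∑-*ʳ : ∀ xs c (f : A → ℤ) → ∑[ x ∈ xs ] (f x * c) ≡ ∑ xs f * c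
    ∑-*ʳ xs c f = trans (∑-cong xs (λ x → ℤ.*-comm (f x) c)) (trans (∑-*ˡ xs c f) (ℤ.*-comm c (∑ xs f)))

    ∑-const : ∀ (xs : List A) c → ∑[ x ∈ xs ] c ≡ + length xs * c
    ∑-const []       c = sym (ℤ.*-zeroˡ c)
    ∑-const (x ∷ xs) c = trans (cong (_+_ c) (∑-const xs c)) (sym (ℤ.suc-* (+ length xs) c))

    ∑-mono-≤ : ∀ xs {f g : A → ℤ} → (∀ x → f x ≤ g x) → ∑ xs f ≤ ∑ xs g
    ∑-mono-≤ []       f≤g = ℤ.≤-refl
    ∑-mono-≤ (x ∷ xs) f≤g = ℤ.+-mono-≤ (f≤g x) (∑-mono-≤ xs f≤g)

    ∑-nonNeg : ∀ xs {f : A → ℤ} → (∀ x → 0ℤ ≤ f x) → 0ℤ ≤ ∑ xs f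
    ∑-nonNeg []       0≤f = ℤ.≤-refl
    ∑-nonNeg (x ∷ xs) 0≤f = ℤ.+-mono-≤ (0≤f x) (∑-nonNeg xs 0≤f)

    term≤∑ : ∀ {xs x} {f : A → ℤ} → x ∈ xs → (∀ y → 0ℤ ≤ f y) → f x ≤ ∑ xs f
    term≤∑ {y ∷ xs} {f = f} (here refl) 0≤f =
      subst (_≤ f y + ∑ xs f) (ℤ.+-identityʳ (f y)) (ℤ.+-monoʳ-≤ (f y) (∑-nonNeg xs 0≤f))
    term≤∑ {y ∷ xs} {x} {f} (there x∈xs) 0≤f =
      subst (_≤ f y + ∑ xs f) (ℤ.+-identityˡ (f x)) (ℤ.+-mono-≤ (0≤f y) (term≤∑ x∈xs 0≤f))

    ∑-++ : ∀ xs ys (f : A → ℤ) → ∑ (xs ++ ys) f ≡ ∑ xs f + ∑ ys f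
    ∑-++ []       ys f = sym (ℤ.+-identityˡ (∑ ys f))
    ∑-++ (x ∷ xs) ys f = trans (cong (_+_ (f x)) (∑-++ xs ys f)) (sym (ℤ.+-assoc (f x) (∑ xs f) (∑ ys f)))

    ∑-filter : ∀ {p} {P : A → Set p} (P? : ∀ x → Dec (P x)) xs (f : A → ℤ) →
               ∑ (filter P? xs) f ≡ ∑[ x ∈ xs ] (𝟙 (P? x) * f x)
    ∑-filter P? []       f = refl
    ∑-filter P? (x ∷ xs) f with does (P? x)
    ... | true  = cong₂ _+_ (sym (ℤ.*-identityˡ (f x))) (∑-filter P? xs f)
    ... | false = trans (∑-filter P? xs f) (sym (ℤ.+-identityˡ _))

    length-filter : ∀ {p} {P : A → Set p} (P? : ∀ x → Dec (P x)) xs →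
                    + length (filter P? xs) ≡ ∑[ x ∈ xs ] 𝟙 (P? x)
    length-filter P? xs = begin
      + length (filter P? xs)                ≡⟨ sym (ℤ.*-identityʳ _) ⟩
      + length (filter P? xs) * 1ℤ           ≡⟨ sym (∑-const (filter P? xs) 1ℤ) ⟩
      ∑[ x ∈ filter P? xs ] 1ℤ               ≡⟨ ∑-filter P? xs _ ⟩
      ∑[ x ∈ xs ] (𝟙 (P? x) * 1ℤ)            ≡⟨ ∑-cong xs (λ x → ℤ.*-identityʳ _) ⟩
      ∑[ x ∈ xs ] 𝟙 (P? x)                   ∎
      where open ≡-Reasoning

    ∑-deviation² : ∀ xs (f : A → ℤ) t → ∑[ x ∈ xs ] ((f x - t) * (f x - t)) ≡
                   ∑[ x ∈ xs ] (f x * f x) - + 2 * t * ∑ xs f + + length xs * (t * t)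
    ∑-deviation² xs f t = begin
      ∑[ x ∈ xs ] ((f x - t) * (f x - t))                        ≡⟨ ∑-cong xs (λ x → expand (f x) t) ⟩
      ∑[ x ∈ xs ] (f x * f x + (- (+ 2 * t) * f x + t * t))      ≡⟨ ∑-distrib-+ xs _ _ ⟩
      ∑ xs (λ x → f x * f x) + ∑[ x ∈ xs ] (- (+ 2 * t) * f x + t * t)
        ≡⟨ cong (_+_ (∑ xs (λ x → f x * f x))) (trans (∑-distrib-+ xs (λ x → - (+ 2 * t) * f x) (λ _ → t * t))
                                                    (cong₂ _+_ (∑-*ˡ xs (- (+ 2 * t)) f) (∑-const xs (t * t)))) ⟩
      ∑ xs (λ x → f x * f x) + (- (+ 2 * t) * ∑ xs f + + length xs * (t * t))
        ≡⟨ regroup (∑ xs (λ x → f x * f x)) (∑ xs f) (+ length xs) t ⟩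
      ∑ xs (λ x → f x * f x) - + 2 * t * ∑ xs f + + length xs * (t * t) ∎
      where
      open ≡-Reasoning
      expand : ∀ a t → (a - t) * (a - t) ≡ a * a + (- (+ 2 * t) * a + t * t)
      expand = solve-∀
      regroup : ∀ q a n t → q + (- (+ 2 * t) * a + n * (t * t)) ≡ q - + 2 * t * a + n * (t * t)
      regroup = solve-∀

  ∑-comm : ∀ {A B : Set} xs ys (f : A → B → ℤ) → ∑[ x ∈ xs ] ∑[ y ∈ ys ] f x y ≡ ∑[ y ∈ ys ] ∑[ x ∈ xs ] f x y
  ∑-comm []       ys f = sym (trans (∑-const ys 0ℤ) (ℤ.*-zeroʳ (+ length ys)))
  ∑-comm (x ∷ xs) ys f = trans (cong (_+_ (∑ ys (f x))) (∑-comm xs ys f)) (sym (∑-distrib-+ ys (f x) _))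

  ∑-map : ∀ {A B : Set} (g : A → B) xs (f : B → ℤ) → ∑ (map g xs) f ≡ ∑[ x ∈ xs ] f (g x)
  ∑-map g []       f = refl
  ∑-map g (x ∷ xs) f = cong (_+_ (f (g x))) (∑-map g xs f)

  length-grid : ∀ {A B : Set} (xs : List A) (ys : List B) →
                length (concatMap (λ a → map (a ,_) ys) xs) ≡ length xs ℕ.* length ys
  length-grid []       ys = refl
  length-grid (x ∷ xs) ys =
    trans (List.length-++ (map (x ,_) ys)) (cong₂ ℕ._+_ (List.length-map (x ,_) ys) (length-grid xs ys))

  length-allFin : ∀ n → length (allFin n) ≡ n
  length-allFin n = List.length-tabulate id

  ∑-allFin-const : ∀ n c → ∑[ i ∈ allFin n ] c ≡ + n * c
  ∑-allFin-const n c = trans (∑-const (allFin n) c) (cong (λ m → + m * c) (length-allFin n))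

  ∑-grid : ∀ {A B : Set} xs ys (f : A × B → ℤ) →
           ∑ (concatMap (λ a → map (a ,_) ys) xs) f ≡ ∑[ a ∈ xs ] ∑[ b ∈ ys ] f (a , b)
  ∑-grid []       ys f = refl
  ∑-grid (x ∷ xs) ys f = trans (∑-++ (map (x ,_) ys) _ f) (cong₂ _+_ (∑-map (x ,_) ys f) (∑-grid xs ys f))

  ∑-allFin-suc : ∀ {n} (f : Fin (suc n) → ℤ) → ∑ (allFin (suc n)) f ≡ f Fin.zero + ∑[ i ∈ allFin n ] f (Fin.suc i)
  ∑-allFin-suc {n} f = cong (_+_ (f Fin.zero))
    (trans (cong (λ xs → ∑ xs f) (sym (List.map-tabulate id Fin.suc))) (∑-map Fin.suc (allFin n) f))

  ∑-δ : ∀ {n} (c : Fin n) (g : Fin n → ℤ) → ∑[ b ∈ allFin n ] (𝟙 (c Fin.≟ b) * g b) ≡ g c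
  ∑-δ {suc n} Fin.zero g = trans (∑-allFin-suc (λ b → 𝟙 (Fin.zero Fin.≟ b) * g b))
    (trans (cong (_+_ (1ℤ * g Fin.zero)) (trans (∑-allFin-const n 0ℤ) (ℤ.*-zeroʳ (+ n))))
           (trans (ℤ.+-identityʳ _) (ℤ.*-identityˡ _)))
  ∑-δ {suc n} (Fin.suc c) g = trans (∑-allFin-suc (λ b → 𝟙 (Fin.suc c Fin.≟ b) * g b))
    (trans (ℤ.+-identityˡ _) (∑-δ c (g ∘ Fin.suc)))

  ∑*∑ : ∀ {A B : Set} xs ys (f : A → ℤ) (g : B → ℤ) → ∑ xs f * ∑ ys g ≡ ∑[ x ∈ xs ] ∑[ y ∈ ys ] (f x * g y)
  ∑*∑ xs ys f g = trans (sym (∑-*ʳ xs (∑ ys g) f)) (∑-cong xs (λ x → sym (∑-*ˡ ys (f x) g)))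

  ∑-square : ∀ {A B : Set} xs ys (w : B → A → ℤ) →
             ∑[ x ∈ xs ] (∑[ i ∈ ys ] w i x * ∑[ i ∈ ys ] w i x) ≡ ∑[ i ∈ ys ] ∑[ i′ ∈ ys ] ∑[ x ∈ xs ] (w i x * w i′ x)
  ∑-square xs ys w = begin
    ∑[ x ∈ xs ] (∑[ i ∈ ys ] w i x * ∑[ i ∈ ys ] w i x)        ≡⟨ ∑-cong xs (λ x → ∑*∑ ys ys (λ i → w i x) (λ i → w i x)) ⟩
    ∑[ x ∈ xs ] ∑[ i ∈ ys ] ∑[ i′ ∈ ys ] (w i x * w i′ x)      ≡⟨ ∑-comm xs ys _ ⟩
    ∑[ i ∈ ys ] ∑[ x ∈ xs ] ∑[ i′ ∈ ys ] (w i x * w i′ x)      ≡⟨ ∑-cong ys (λ i → ∑-comm xs ys _) ⟩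
    ∑[ i ∈ ys ] ∑[ i′ ∈ ys ] ∑[ x ∈ xs ] (w i x * w i′ x)      ∎
    where open ≡-Reasoning

  ∑-𝟙≟ : ∀ {n} (c : Fin n) → ∑[ b ∈ allFin n ] 𝟙 (c Fin.≟ b) ≡ 1ℤ
  ∑-𝟙≟ c = trans (∑-cong (allFin _) (λ b → sym (ℤ.*-identityʳ (𝟙 (c Fin.≟ b))))) (∑-δ c (λ _ → 1ℤ))

  ∑-pairs< : ∀ k (h : Fin k × Fin k → ℤ) →
             ∑ (pairs< k) h ≡ ∑[ a ∈ allFin k ] ∑[ b ∈ allFin k ] (𝟙 (toℕ a ℕ.<? toℕ b) * h (a , b))
  ∑-pairs< k h =
    trans (∑-filter (λ p → toℕ (proj₁ p) ℕ.<? toℕ (proj₂ p)) (concatMap (λ a → map (a ,_) (allFin k)) (allFin k)) h)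
          (∑-grid (allFin k) (allFin k) _)

  private
    𝟙-trichotomy : ∀ {k} (a b : Fin k) → 𝟙 (toℕ a ℕ.<? toℕ b) + 𝟙 (toℕ b ℕ.<? toℕ a) + 𝟙 (a Fin.≟ b) ≡ 1ℤ
    𝟙-trichotomy a b with ℕ.<-cmp (toℕ a) (toℕ b)
    ... | tri< a<b _ _ = cong₂ _+_ (cong₂ _+_ (𝟙-true (toℕ a ℕ.<? toℕ b) a<b) (𝟙-false (toℕ b ℕ.<? toℕ a) (ℕ.<⇒≯ a<b)))
                                   (𝟙-false (a Fin.≟ b) (λ a≡b → ℕ.<-irrefl (cong toℕ a≡b) a<b))
    ... | tri> _ _ b<a = cong₂ _+_ (cong₂ _+_ (𝟙-false (toℕ a ℕ.<? toℕ b) (ℕ.<⇒≯ b<a)) (𝟙-true (toℕ b ℕ.<? toℕ a) b<a))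
                                   (𝟙-false (a Fin.≟ b) (λ a≡b → ℕ.<-irrefl (cong toℕ (sym a≡b)) b<a))
    ... | tri≈ _ a≈b _ with Fin.toℕ-injective a≈b
    ...   | refl = cong₂ _+_ (cong₂ _+_ (𝟙-false (toℕ a ℕ.<? toℕ a) (ℕ.<-irrefl refl)) (𝟙-false (toℕ a ℕ.<? toℕ a) (ℕ.<-irrefl refl)))
                             (𝟙-true (a Fin.≟ a) refl)

  ∑-pairs<-symmetric : ∀ k (h : Fin k × Fin k → ℤ) → (∀ a b → h (a , b) ≡ h (b , a)) →
    + 2 * ∑ (pairs< k) h ≡ ∑[ a ∈ allFin k ] ∑[ b ∈ allFin k ] h (a , b) - ∑[ a ∈ allFin k ] h (a , a)
  ∑-pairs<-symmetric k h h-sym = begin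
    + 2 * ∑ (pairs< k) h                      ≡⟨ cong (+ 2 *_) (∑-pairs< k h) ⟩
    + 2 * below                               ≡⟨ twice below diagonal ⟩
    below + below + diagonal - diagonal       ≡⟨ cong (_- diagonal) (sym total) ⟩
    ∑[ a ∈ F ] ∑[ b ∈ F ] h (a , b) - diagonal ∎
    where
    open ≡-Reasoning
    F : List (Fin k)
    F = allFin k
    lt : Fin k → Fin k → ℤ
    lt a b = 𝟙 (toℕ a ℕ.<? toℕ b)
    below diagonal : ℤ
    below = ∑[ a ∈ F ] ∑[ b ∈ F ] (lt a b * h (a , b))
    diagonal = ∑[ a ∈ F ] h (a , a)
    split : ∀ a b → h (a , b) ≡ lt a b * h (a , b) + lt b a * h (a , b) + 𝟙 (a Fin.≟ b) * h (a , b)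
    split a b = trans (sym (ℤ.*-identityˡ _))
      (trans (cong (_* h (a , b)) (sym (𝟙-trichotomy a b))) (distrib (lt a b) (lt b a) (𝟙 (a Fin.≟ b)) (h (a , b))))
      where distrib : ∀ x y z w → (x + y + z) * w ≡ x * w + y * w + z * w
            distrib = solve-∀
    mirror : ∑[ a ∈ F ] ∑[ b ∈ F ] (lt b a * h (a , b)) ≡ below
    mirror = trans (∑-comm F F _) (∑-cong F (λ b → ∑-cong F (λ a → cong (lt b a *_) (h-sym a b))))
    diag : ∑[ a ∈ F ] ∑[ b ∈ F ] (𝟙 (a Fin.≟ b) * h (a , b)) ≡ diagonal
    diag = ∑-cong F (λ a → ∑-δ a (λ b → h (a , b)))
    total : ∑[ a ∈ F ] ∑[ b ∈ F ] h (a , b) ≡ below + below + diagonal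
    total = begin
      ∑[ a ∈ F ] ∑[ b ∈ F ] h (a , b)
        ≡⟨ ∑-cong F (λ a → ∑-cong F (split a)) ⟩
      ∑[ a ∈ F ] ∑[ b ∈ F ] (lt a b * h (a , b) + lt b a * h (a , b) + 𝟙 (a Fin.≟ b) * h (a , b))
        ≡⟨ ∑-cong F (λ a → trans (∑-distrib-+ F _ _) (cong (_+ ∑[ b ∈ F ] (𝟙 (a Fin.≟ b) * h (a , b))) (∑-distrib-+ F _ _))) ⟩
      ∑[ a ∈ F ] (∑[ b ∈ F ] (lt a b * h (a , b)) + ∑[ b ∈ F ] (lt b a * h (a , b)) + ∑[ b ∈ F ] (𝟙 (a Fin.≟ b) * h (a , b)))
        ≡⟨ trans (∑-distrib-+ F _ _) (cong (_+ ∑[ a ∈ F ] ∑[ b ∈ F ] (𝟙 (a Fin.≟ b) * h (a , b))) (∑-distrib-+ F _ _)) ⟩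
      below + ∑[ a ∈ F ] ∑[ b ∈ F ] (lt b a * h (a , b)) + ∑[ a ∈ F ] ∑[ b ∈ F ] (𝟙 (a Fin.≟ b) * h (a , b))
        ≡⟨ cong₂ (λ u v → below + u + v) mirror diag ⟩
      below + below + diagonal ∎
    twice : ∀ p d → + 2 * p ≡ p + p + d - d
    twice = solve-∀

module Polynomials where

  open RationalEmbedding

  module _ (R : RawRing 0ℓ 0ℓ) where

    open RawRing R

    private
      infixl 6 _-_
      _-_ : Carrier → Carrier → Carrier
      x - y = x + - y

    -- 2L with ⌊γ⌋ replaced by g, after clearing γ by γ(λs² − 1) = (λs − 1)k; stated over any
    -- raw ring so that the one formula is read in ℤ, in ℚ and in the syntax of both ring solvers.
    twiceL : (l s k g : Carrier) → Carrier
    twiceL l s k g =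
      l * (s * s) * ((1# + 1#) * g * ((l * s - 1#) * k) - (l * (s * s) - 1#) * (g * (g + 1#)) - (l - 1#) * (k * (k - 1#)))

  infixl 6 _⊕_
  infixl 7 _⊛_
  infix  8 ⊝_

  data Expr : Set where
    ‵_  : ℤ → Expr
    ⊝_  : Expr → Expr
    _⊕_ _⊛_ : Expr → Expr → Expr

  Expr-rawRing : RawRing 0ℓ 0ℓ
  Expr-rawRing = record { _≈_ = _≡_ ; _+_ = _⊕_ ; _*_ = _⊛_ ; -_ = ⊝_ ; 0# = ‵ 0ℤ ; 1# = ‵ 1ℤ }

  ⟦_⟧ℤ : Expr → ℤ
  ⟦ ‵ z ⟧ℤ   = z
  ⟦ ⊝ a ⟧ℤ   = ℤ.- ⟦ a ⟧ℤ
  ⟦ a ⊕ b ⟧ℤ = ⟦ a ⟧ℤ ℤ.+ ⟦ b ⟧ℤ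
  ⟦ a ⊛ b ⟧ℤ = ⟦ a ⟧ℤ ℤ.* ⟦ b ⟧ℤ

  ⟦_⟧ℚ : Expr → ℚ
  ⟦ ‵ z ⟧ℚ   = ιℤ z
  ⟦ ⊝ a ⟧ℚ   = ℚ.- ⟦ a ⟧ℚ
  ⟦ a ⊕ b ⟧ℚ = ⟦ a ⟧ℚ ℚ.+ ⟦ b ⟧ℚ
  ⟦ a ⊛ b ⟧ℚ = ⟦ a ⟧ℚ ℚ.* ⟦ b ⟧ℚ

  ιℤ-⟦⟧ : ∀ e → ιℤ ⟦ e ⟧ℤ ≡ ⟦ e ⟧ℚ
  ιℤ-⟦⟧ (‵ z)   = refl
  ιℤ-⟦⟧ (⊝ a)   = trans (ιℤ-neg ⟦ a ⟧ℤ) (cong ℚ.-_ (ιℤ-⟦⟧ a))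
  ιℤ-⟦⟧ (a ⊕ b) = trans (ιℤ-+ ⟦ a ⟧ℤ ⟦ b ⟧ℤ) (cong₂ ℚ._+_ (ιℤ-⟦⟧ a) (ιℤ-⟦⟧ b))
  ιℤ-⟦⟧ (a ⊛ b) = trans (ιℤ-* ⟦ a ⟧ℤ ⟦ b ⟧ℤ) (cong₂ ℚ._*_ (ιℤ-⟦⟧ a) (ιℤ-⟦⟧ b))

  ℤ-syntax : ℕ → RawRing 0ℓ 0ℓ
  ℤ-syntax n = record { Carrier = Polynomial n ; _≈_ = _≡_ ; _+_ = _:+_ ; _*_ = _:*_ ; -_ = :-_ ; 0# = con 0ℤ ; 1# = con 1ℤ }
    where open ℤ-Solver

  ℚ-syntax : ℕ → RawRing 0ℓ 0ℓ
  ℚ-syntax n = record { Carrier = Polynomial n ; _≈_ = _≡_ ; _+_ = _:+_ ; _*_ = _:*_ ; -_ = :-_ ; 0# = con 0ℚ ; 1# = con 1ℚ }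
    where open ℚ-Solver

open Polynomials using (twiceL; ℤ-syntax; ℚ-syntax)

twoL : ℤ → ℤ → ℤ → ℤ → ℤ
twoL = twiceL ℤ.+-*-rawRing

ιℤ-twoL : ∀ l s k g → ιℤ (twoL l s k g) ≡ twiceL ℚ.+-*-rawRing (ιℤ l) (ιℤ s) (ιℤ k) (ιℤ g)
ιℤ-twoL l s k g = Polynomials.ιℤ-⟦⟧ (twiceL Polynomials.Expr-rawRing (‵ l) (‵ s) (‵ k) (‵ g))
  where open Polynomials using (‵_)


module Unbalance {N k s : ℕ} (A : Array N k s) where

  open IntegerOrder
  open ListSums
  open import Data.Integer.Base using (_+_; _*_; _-_; -_; _≤_)
  open import Data.List.Membership.Propositional.Properties using (∈-allFin)

  rows : List (Fin N)
  rows = allFin N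

  rowPairs : List (Fin N × Fin N)
  rowPairs = concatMap (λ i → map (i ,_) rows) rows

  columns : List (Fin k)
  columns = allFin k

  symbols : List (Fin s)
  symbols = allFin s

  agree : Fin N × Fin N → Fin k → ℤ
  agree (i , i′) j = 𝟙 (A i′ j Fin.≟ A i j)

  coincidences : Fin N × Fin N → ℤ
  coincidences p = ∑[ j ∈ columns ] agree p j

  columnCount : Fin k → Fin s → ℤ
  columnCount j a = ∑[ i ∈ rows ] 𝟙 (A i j Fin.≟ a)

  pairCount : Fin s × Fin s → Fin k × Fin k → ℤ
  pairCount (a , b) (j , j′) = ∑[ i ∈ rows ] (𝟙 (A i j Fin.≟ a) * 𝟙 (A i j′ Fin.≟ b))

  pairAgreement : Fin k × Fin k → ℤ
  pairAgreement (j , j′) = ∑[ p ∈ rowPairs ] (agree p j * agree p j′)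

  unbalance : ℤ → ℤ
  unbalance l = ∑[ x ∈ points s ] ∑[ j ∈ pairs< k ] ((+ count A x j - l) * (+ count A x j - l))

  count≡pairCount : ∀ x j → + count A x j ≡ pairCount x j
  count≡pairCount (a , b) (j , j′) =
    trans (length-filter (λ i → (A i j Fin.≟ a) ×-dec (A i j′ Fin.≟ b)) rows)
          (∑-cong rows (λ i → 𝟙-× (A i j Fin.≟ a) (A i j′ Fin.≟ b)))

  private
    ∑-allFin-1 : ∀ n → ∑[ i ∈ allFin n ] 1ℤ ≡ + n
    ∑-allFin-1 n = trans (∑-allFin-const n 1ℤ) (ℤ.*-identityʳ (+ n))

    length-rowPairs : + length rowPairs ≡ + N * + N
    length-rowPairs =
      trans (cong +_ (trans (length-grid rows rows) (cong₂ ℕ._*_ (length-allFin N) (length-allFin N)))) (ℤ.pos-* N N)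

    length-points : + length (points s) ≡ + s * + s
    length-points =
      trans (cong +_ (trans (length-grid symbols symbols) (cong₂ ℕ._*_ (length-allFin s) (length-allFin s)))) (ℤ.pos-* s s)

    ∑-square-rows : ∀ {X : Set} xs (w : Fin N → X → ℤ) →
      ∑[ x ∈ xs ] (∑[ i ∈ rows ] w i x * ∑[ i ∈ rows ] w i x) ≡
      ∑[ p ∈ rowPairs ] ∑[ x ∈ xs ] (w (proj₁ p) x * w (proj₂ p) x)
    ∑-square-rows xs w =
      trans (∑-square xs rows w) (sym (∑-grid rows rows (λ p → ∑[ x ∈ xs ] (w (proj₁ p) x * w (proj₂ p) x))))

  ∑-columnCount : ∀ j → ∑[ a ∈ symbols ] columnCount j a ≡ + N
  ∑-columnCount j = trans (∑-comm symbols rows (λ a i → 𝟙 (A i j Fin.≟ a)))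
                          (trans (∑-cong rows (λ i → ∑-𝟙≟ (A i j))) (∑-allFin-1 N))

  ∑-columnCount² : ∀ j → ∑[ a ∈ symbols ] (columnCount j a * columnCount j a) ≡ ∑[ p ∈ rowPairs ] agree p j
  ∑-columnCount² j = trans (∑-square-rows symbols (λ i a → 𝟙 (A i j Fin.≟ a)))
                           (∑-cong rowPairs (λ p → ∑-δ (A (proj₁ p) j) (λ a → 𝟙 (A (proj₂ p) j Fin.≟ a))))

  ∑-pairCount : ∀ j → ∑[ x ∈ points s ] pairCount x j ≡ + N
  ∑-pairCount (j , j′) = begin
    ∑[ x ∈ points s ] pairCount x (j , j′)
      ≡⟨ ∑-grid symbols symbols (λ x → pairCount x (j , j′)) ⟩
    ∑[ a ∈ symbols ] ∑[ b ∈ symbols ] ∑[ i ∈ rows ] (δ i j a * δ i j′ b)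
      ≡⟨ ∑-cong symbols (λ a → ∑-comm symbols rows (λ b i → δ i j a * δ i j′ b)) ⟩
    ∑[ a ∈ symbols ] ∑[ i ∈ rows ] ∑[ b ∈ symbols ] (δ i j a * δ i j′ b)
      ≡⟨ ∑-comm symbols rows (λ a i → ∑[ b ∈ symbols ] (δ i j a * δ i j′ b)) ⟩
    ∑[ i ∈ rows ] ∑[ a ∈ symbols ] ∑[ b ∈ symbols ] (δ i j a * δ i j′ b)
      ≡⟨ ∑-cong rows (λ i → trans (sym (∑*∑ symbols symbols (δ i j) (δ i j′))) (cong₂ _*_ (∑-𝟙≟ (A i j)) (∑-𝟙≟ (A i j′)))) ⟩
    ∑[ i ∈ rows ] 1ℤ
      ≡⟨ ∑-allFin-1 N ⟩
    + N ∎
    where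
    open ≡-Reasoning
    δ : Fin N → Fin k → Fin s → ℤ
    δ i j a = 𝟙 (A i j Fin.≟ a)

  ∑-pairCount² : ∀ j → ∑[ x ∈ points s ] (pairCount x j * pairCount x j) ≡ pairAgreement j
  ∑-pairCount² (j , j′) = trans (∑-square-rows (points s) w) (∑-cong rowPairs inner)
    where
    open ≡-Reasoning
    δ : Fin N → Fin k → Fin s → ℤ
    δ i j a = 𝟙 (A i j Fin.≟ a)
    w : Fin N → Fin s × Fin s → ℤ
    w i (a , b) = δ i j a * δ i j′ b
    rearrange : ∀ x y u v → (x * y) * (u * v) ≡ (x * u) * (y * v)
    rearrange = solve-∀
    inner : ∀ p → ∑[ x ∈ points s ] (w (proj₁ p) x * w (proj₂ p) x) ≡ agree p j * agree p j′
    inner (i , i′) = begin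
      ∑[ x ∈ points s ] (w i x * w i′ x)
        ≡⟨ ∑-grid symbols symbols (λ x → w i x * w i′ x) ⟩
      ∑[ a ∈ symbols ] ∑[ b ∈ symbols ] ((δ i j a * δ i j′ b) * (δ i′ j a * δ i′ j′ b))
        ≡⟨ ∑-cong symbols (λ a → ∑-cong symbols (λ b → rearrange (δ i j a) (δ i j′ b) (δ i′ j a) (δ i′ j′ b))) ⟩
      ∑[ a ∈ symbols ] ∑[ b ∈ symbols ] ((δ i j a * δ i′ j a) * (δ i j′ b * δ i′ j′ b))
        ≡⟨ sym (∑*∑ symbols symbols (λ a → δ i j a * δ i′ j a) (λ b → δ i j′ b * δ i′ j′ b)) ⟩
      ∑[ a ∈ symbols ] (δ i j a * δ i′ j a) * ∑[ b ∈ symbols ] (δ i j′ b * δ i′ j′ b)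
        ≡⟨ cong₂ _*_ (∑-δ (A i j) (δ i′ j)) (∑-δ (A i j′) (δ i′ j′)) ⟩
      agree (i , i′) j * agree (i , i′) j′ ∎

  unbalance≡∑pairAgreement : ∀ l → unbalance l ≡ ∑[ j ∈ pairs< k ] (pairAgreement j + (+ s * + s * (l * l) - + 2 * l * + N))
  unbalance≡∑pairAgreement l = begin
    unbalance l
      ≡⟨ ∑-cong (points s) (λ x → ∑-cong (pairs< k) (λ j → cong (λ c → (c - l) * (c - l)) (count≡pairCount x j))) ⟩
    ∑[ x ∈ points s ] ∑[ j ∈ pairs< k ] ((pairCount x j - l) * (pairCount x j - l))
      ≡⟨ ∑-comm (points s) (pairs< k) (λ x j → (pairCount x j - l) * (pairCount x j - l)) ⟩
    ∑[ j ∈ pairs< k ] ∑[ x ∈ points s ] ((pairCount x j - l) * (pairCount x j - l))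
      ≡⟨ ∑-cong (pairs< k) deviation ⟩
    ∑[ j ∈ pairs< k ] (pairAgreement j + (+ s * + s * (l * l) - + 2 * l * + N)) ∎
    where
    open ≡-Reasoning
    regroup : ∀ q n m l → q - + 2 * l * n + m * (l * l) ≡ q + (m * (l * l) - + 2 * l * n)
    regroup = solve-∀
    deviation : ∀ j → ∑[ x ∈ points s ] ((pairCount x j - l) * (pairCount x j - l)) ≡
                      pairAgreement j + (+ s * + s * (l * l) - + 2 * l * + N)
    deviation j = trans (∑-deviation² (points s) (λ x → pairCount x j) l)
      (trans (cong₂ (λ q n → q - + 2 * l * n + + length (points s) * (l * l)) (∑-pairCount² j) (∑-pairCount j))
        (trans (cong (λ m → pairAgreement j - + 2 * l * + N + m * (l * l)) length-points)
          (regroup (pairAgreement j) (+ N) (+ s * + s) l)))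

  twice-unbalance : ∀ l → + 2 * unbalance l ≡
    ∑[ p ∈ rowPairs ] (coincidences p * coincidences p - coincidences p) + (+ k * + k - + k) * (+ s * + s * (l * l) - + 2 * l * + N)
  twice-unbalance l = begin
    + 2 * unbalance l
      ≡⟨ cong (+ 2 *_) (trans (unbalance≡∑pairAgreement l) (∑-distrib-+ (pairs< k) pairAgreement (λ _ → c))) ⟩
    + 2 * (∑ (pairs< k) pairAgreement + ∑[ j ∈ pairs< k ] c)
      ≡⟨ ℤ.*-distribˡ-+ (+ 2) (∑ (pairs< k) pairAgreement) (∑[ j ∈ pairs< k ] c) ⟩
    + 2 * ∑ (pairs< k) pairAgreement + + 2 * ∑[ j ∈ pairs< k ] c
      ≡⟨ cong₂ _+_ (∑-pairs<-symmetric k pairAgreement symmetric) (∑-pairs<-symmetric k (λ _ → c) (λ _ _ → refl)) ⟩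
    (∑[ j ∈ columns ] ∑[ j′ ∈ columns ] pairAgreement (j , j′) - ∑[ j ∈ columns ] pairAgreement (j , j))
      + (∑[ j ∈ columns ] ∑[ j′ ∈ columns ] c - ∑[ j ∈ columns ] c)
      ≡⟨ cong₂ _+_ (cong₂ _-_ all-pairs diagonal) constants ⟩
    (∑[ p ∈ rowPairs ] (coincidences p * coincidences p) - ∑ rowPairs coincidences) + (+ k * (+ k * c) - + k * c)
      ≡⟨ cong₂ _+_ (sym (∑-distrib-− rowPairs (λ p → coincidences p * coincidences p) coincidences)) (regroup (+ k) c) ⟩
    ∑[ p ∈ rowPairs ] (coincidences p * coincidences p - coincidences p) + (+ k * + k - + k) * c ∎
    where
    open ≡-Reasoning
    c : ℤ
    c = + s * + s * (l * l) - + 2 * l * + N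
    regroup : ∀ k c → k * (k * c) - k * c ≡ (k * k - k) * c
    regroup = solve-∀
    symmetric : ∀ j j′ → pairAgreement (j , j′) ≡ pairAgreement (j′ , j)
    symmetric j j′ = ∑-cong rowPairs (λ p → ℤ.*-comm (agree p j) (agree p j′))
    all-pairs : ∑[ j ∈ columns ] ∑[ j′ ∈ columns ] pairAgreement (j , j′) ≡ ∑[ p ∈ rowPairs ] (coincidences p * coincidences p)
    all-pairs = begin
      ∑[ j ∈ columns ] ∑[ j′ ∈ columns ] ∑[ p ∈ rowPairs ] (agree p j * agree p j′)
        ≡⟨ ∑-cong columns (λ j → ∑-comm columns rowPairs (λ j′ p → agree p j * agree p j′)) ⟩
      ∑[ j ∈ columns ] ∑[ p ∈ rowPairs ] ∑[ j′ ∈ columns ] (agree p j * agree p j′)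
        ≡⟨ ∑-comm columns rowPairs (λ j p → ∑[ j′ ∈ columns ] (agree p j * agree p j′)) ⟩
      ∑[ p ∈ rowPairs ] ∑[ j ∈ columns ] ∑[ j′ ∈ columns ] (agree p j * agree p j′)
        ≡⟨ ∑-cong rowPairs (λ p → sym (∑*∑ columns columns (agree p) (agree p))) ⟩
      ∑[ p ∈ rowPairs ] (coincidences p * coincidences p) ∎
    diagonal : ∑[ j ∈ columns ] pairAgreement (j , j) ≡ ∑ rowPairs coincidences
    diagonal = trans (∑-cong columns (λ j → ∑-cong rowPairs (λ p → 𝟙-idem (A (proj₂ p) j Fin.≟ A (proj₁ p) j))))
                     (∑-comm columns rowPairs (λ j p → agree p j))
    constants : ∑[ j ∈ columns ] ∑[ j′ ∈ columns ] c - ∑[ j ∈ columns ] c ≡ + k * (+ k * c) - + k * c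
    constants = cong₂ _-_ (trans (∑-cong columns (λ j → ∑-allFin-const k c)) (∑-allFin-const k (+ k * c))) (∑-allFin-const k c)

  coincidences-diagonal : ∀ i → coincidences (i , i) ≡ + k
  coincidences-diagonal i = trans (∑-cong columns (λ j → 𝟙-true (A i j Fin.≟ A i j) refl)) (∑-allFin-1 k)

  ∑-coincidences : ∑ rowPairs coincidences ≡ ∑[ j ∈ columns ] ∑[ a ∈ symbols ] (columnCount j a * columnCount j a)
  ∑-coincidences = trans (∑-comm rowPairs columns agree) (∑-cong columns (λ j → sym (∑-columnCount² j)))

  ∑-columnCount²-lower : ∀ j t → + 2 * t * + N - + s * (t * t) ≤ ∑[ a ∈ symbols ] (columnCount j a * columnCount j a)
  ∑-columnCount²-lower j t =
    ℤ.0≤i-j⇒j≤i (subst (0ℤ ≤_) deviation (∑-nonNeg symbols (λ a → square-nonNeg (columnCount j a - t))))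
    where
    Q : ℤ
    Q = ∑[ a ∈ symbols ] (columnCount j a * columnCount j a)
    regroup : ∀ q t n s → q - + 2 * t * n + s * (t * t) ≡ q - (+ 2 * t * n - s * (t * t))
    regroup = solve-∀
    deviation : ∑[ a ∈ symbols ] ((columnCount j a - t) * (columnCount j a - t)) ≡ Q - (+ 2 * t * + N - + s * (t * t))
    deviation = trans (∑-deviation² symbols (columnCount j) t)
      (trans (cong₂ (λ n m → Q - + 2 * t * n + + m * (t * t)) (∑-columnCount j) (length-allFin s)) (regroup Q t (+ N) (+ s)))

  ∑[c²-c]-lower : ∀ g t → 0ℤ ≤ g →
    + N * ((+ k - g) * (+ k - g - 1ℤ)) + + 2 * g * (+ k * (+ 2 * t * + N - + s * (t * t))) - + N * + N * (g * (g + 1ℤ))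
      ≤ ∑[ p ∈ rowPairs ] (coincidences p * coincidences p - coincidences p)
  ∑[c²-c]-lower g t 0≤g = begin
    + N * ((+ k - g) * (+ k - g - 1ℤ)) + + 2 * g * (+ k * (+ 2 * t * + N - + s * (t * t))) - + N * + N * (g * (g + 1ℤ))
      ≤⟨ ℤ.+-monoˡ-≤ (- (+ N * + N * (g * (g + 1ℤ))))
           (ℤ.+-mono-≤ diagonal-lower (ℤ.*-monoˡ-≤-nonNeg (+ 2 * g) {{ℤ.nonNegative 0≤2g}} coincidence-lower)) ⟩
    ∑ rowPairs excess + + 2 * g * ∑ rowPairs coincidences - + N * + N * (g * (g + 1ℤ))
      ≡⟨ sym split ⟩
    ∑[ p ∈ rowPairs ] (coincidences p * coincidences p - coincidences p) ∎
    where
    open ℤ.≤-Reasoning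
    excess : Fin N × Fin N → ℤ
    excess p = (coincidences p - g) * (coincidences p - g - 1ℤ)
    0≤2g : 0ℤ ≤ + 2 * g
    0≤2g = ℤ.*-monoˡ-≤-nonNeg (+ 2) 0≤g
    pointwise : ∀ c g → c * c - c ≡ (c - g) * (c - g - 1ℤ) + + 2 * g * c - g * (g + 1ℤ)
    pointwise = solve-∀
    split : ∑[ p ∈ rowPairs ] (coincidences p * coincidences p - coincidences p)
            ≡ ∑ rowPairs excess + + 2 * g * ∑ rowPairs coincidences - + N * + N * (g * (g + 1ℤ))
    split = begin-equality
      ∑[ p ∈ rowPairs ] (coincidences p * coincidences p - coincidences p)
        ≡⟨ ∑-cong rowPairs (λ p → pointwise (coincidences p) g) ⟩
      ∑[ p ∈ rowPairs ] (excess p + + 2 * g * coincidences p - g * (g + 1ℤ))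
        ≡⟨ ∑-distrib-− rowPairs (λ p → excess p + + 2 * g * coincidences p) (λ _ → g * (g + 1ℤ)) ⟩
      ∑[ p ∈ rowPairs ] (excess p + + 2 * g * coincidences p) - ∑[ p ∈ rowPairs ] (g * (g + 1ℤ))
        ≡⟨ cong₂ _-_ (trans (∑-distrib-+ rowPairs excess (λ p → + 2 * g * coincidences p))
                            (cong (_+_ (∑ rowPairs excess)) (∑-*ˡ rowPairs (+ 2 * g) coincidences)))
                     (trans (∑-const rowPairs (g * (g + 1ℤ))) (cong (_* (g * (g + 1ℤ))) length-rowPairs)) ⟩
      ∑ rowPairs excess + + 2 * g * ∑ rowPairs coincidences - + N * + N * (g * (g + 1ℤ)) ∎
    diagonal-lower : + N * ((+ k - g) * (+ k - g - 1ℤ)) ≤ ∑ rowPairs excess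
    diagonal-lower = begin
      + N * ((+ k - g) * (+ k - g - 1ℤ))       ≡⟨ sym (∑-allFin-const N _) ⟩
      ∑[ i ∈ rows ] ((+ k - g) * (+ k - g - 1ℤ))
        ≡⟨ ∑-cong rows (λ i → cong (λ c → (c - g) * (c - g - 1ℤ)) (sym (coincidences-diagonal i))) ⟩
      ∑[ i ∈ rows ] excess (i , i)
        ≤⟨ ∑-mono-≤ rows (λ i → term≤∑ (∈-allFin i) (λ i′ → consecutive-product-nonNeg (coincidences (i , i′) - g))) ⟩
      ∑[ i ∈ rows ] ∑[ i′ ∈ rows ] excess (i , i′) ≡⟨ sym (∑-grid rows rows excess) ⟩
      ∑ rowPairs excess                         ∎
    coincidence-lower : + k * (+ 2 * t * + N - + s * (t * t)) ≤ ∑ rowPairs coincidences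
    coincidence-lower = begin
      + k * (+ 2 * t * + N - + s * (t * t))     ≡⟨ sym (∑-allFin-const k _) ⟩
      ∑[ j ∈ columns ] (+ 2 * t * + N - + s * (t * t)) ≤⟨ ∑-mono-≤ columns (λ j → ∑-columnCount²-lower j t) ⟩
      ∑[ j ∈ columns ] ∑[ a ∈ symbols ] (columnCount j a * columnCount j a) ≡⟨ sym ∑-coincidences ⟩
      ∑ rowPairs coincidences                   ∎

  twoL-expansion : ∀ l s k g → twoL l s k g ≡
    l * (s * s) * ((k - g) * (k - g - 1ℤ))
    + + 2 * g * (k * (+ 2 * (l * s) * (l * (s * s)) - s * ((l * s) * (l * s))))
    - l * (s * s) * (l * (s * s)) * (g * (g + 1ℤ))
    + (k * k - k) * (s * s * (l * l) - + 2 * l * (l * (s * s)))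
  twoL-expansion = solve 4 (λ l s k g → twiceL (ℤ-syntax 4) l s k g :=
    l :* (s :* s) :* ((k :- g) :* (k :- g :- con 1ℤ))
    :+ con (+ 2) :* g :* (k :* (con (+ 2) :* (l :* s) :* (l :* (s :* s)) :- s :* ((l :* s) :* (l :* s))))
    :- l :* (s :* s) :* (l :* (s :* s)) :* (g :* (g :+ con 1ℤ))
    :+ (k :* k :- k) :* (s :* s :* (l :* l) :- con (+ 2) :* l :* (l :* (s :* s)))) refl
      where open ℤ-Solver

  twoL≤twice-unbalance : ∀ l g → + N ≡ l * (+ s * + s) → 0ℤ ≤ g → twoL l (+ s) (+ k) g ≤ + 2 * unbalance l
  twoL≤twice-unbalance l g N≡ls² 0≤g = begin
    twoL l (+ s) (+ k) g                  ≡⟨ twoL-expansion l (+ s) (+ k) g ⟩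
    bound (l * (+ s * + s))               ≡⟨ cong bound (sym N≡ls²) ⟩
    bound (+ N)
      ≤⟨ ℤ.+-monoˡ-≤ ((+ k * + k - + k) * (+ s * + s * (l * l) - + 2 * l * + N)) (∑[c²-c]-lower g (l * + s) 0≤g) ⟩
    ∑[ p ∈ rowPairs ] (coincidences p * coincidences p - coincidences p) + (+ k * + k - + k) * (+ s * + s * (l * l) - + 2 * l * + N)
                                          ≡⟨ sym (twice-unbalance l) ⟩
    + 2 * unbalance l                     ∎
    where
    open ℤ.≤-Reasoning
    bound : ℤ → ℤ
    bound n = n * ((+ k - g) * (+ k - g - 1ℤ)) + + 2 * g * (+ k * (+ 2 * (l * + s) * n - + s * ((l * + s) * (l * + s))))
              - n * n * (g * (g + 1ℤ))
              + (+ k * + k - + k) * (+ s * + s * (l * l) - + 2 * l * n)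

module LowerBound where

  open RationalEmbedding
  open Floor
  open IntegerOrder
  open TotalDivision
  open Polynomials using (‵_; ⊝_; _⊕_; _⊛_; ιℤ-⟦⟧)

  choose2-pl : ℚ → ℚ
  choose2-pl x = choose2 (floor x) ℚ.+ ιℤ (floor x) ℚ.* (x ℚ.- ιℤ (floor x))

  choose2-pl-at : ∀ g x → ιℤ g ℚ.≤ x → x ℚ.≤ ιℤ (ℤ.suc g) → choose2-pl x ≡ choose2 g ℚ.+ ιℤ g ℚ.* (x ℚ.- ιℤ g)
  choose2-pl-at g x g≤x x≤suc[g] with ℚ.<-cmp x (ιℤ (ℤ.suc g))
  ... | tri< x<suc[g] _ _ = cong (λ f → choose2 f ℚ.+ ιℤ f ℚ.* (x ℚ.- ιℤ f)) (floor-unique {g} {x} g≤x x<suc[g])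
  ... | tri> _ _ suc[g]<x = ⊥-elim (ℚ.<-irrefl refl (ℚ.<-≤-trans suc[g]<x x≤suc[g]))
  ... | tri≈ _ refl _ = trans (cong (λ f → choose2 f ℚ.+ ιℤ f ℚ.* (x ℚ.- ιℤ f)) floor-suc[g])
      (subst (λ u → u ℚ.* (u ℚ.- 1ℚ) ℚ.* ½ ℚ.+ u ℚ.* (u ℚ.- u) ≡ choose2 g ℚ.+ ιℤ g ℚ.* (u ℚ.- ιℤ g))
             (sym (ιℤ-+ 1ℤ g)) (continuity (ιℤ g)))
    where
    open ℚ-Solver
    floor-suc[g] : floor (ιℤ (ℤ.suc g)) ≡ ℤ.suc g
    floor-suc[g] =
      floor-unique {ℤ.suc g} ℚ.≤-refl (ιℤ-mono-< {ℤ.suc g} {ℤ.suc (ℤ.suc g)} (ℤ.suc[i]≤j⇒i<j ℤ.≤-refl))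
    continuity : ∀ G → (1ℚ ℚ.+ G) ℚ.* ((1ℚ ℚ.+ G) ℚ.- 1ℚ) ℚ.* ½ ℚ.+ (1ℚ ℚ.+ G) ℚ.* ((1ℚ ℚ.+ G) ℚ.- (1ℚ ℚ.+ G))
                     ≡ G ℚ.* (G ℚ.- 1ℚ) ℚ.* ½ ℚ.+ G ℚ.* ((1ℚ ℚ.+ G) ℚ.- G)
    continuity = solve 1 (λ G → (con 1ℚ :+ G) :* ((con 1ℚ :+ G) :- con 1ℚ) :* con ½ :+ (con 1ℚ :+ G) :* ((con 1ℚ :+ G) :- (con 1ℚ :+ G))
                              := G :* (G :- con 1ℚ) :* con ½ :+ G :* ((con 1ℚ :+ G) :- G)) refl

  γ : (λ′ s s² k : ℚ) → ℚ
  γ λ′ s s² k = ((λ′ ℚ.* s ℚ.- 1ℚ) ℚ.* k) ÷' (λ′ ℚ.* s² ℚ.- 1ℚ)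

  -- Lbound with λ, s, s² and k as parameters, so that λ and s² can be rewritten.
  L : (λ′ s s² k : ℚ) → ℚ
  L λ′ s s² k = λ′ ℚ.* s² ℚ.* (λ′ ℚ.* s² ℚ.- 1ℚ) ℚ.* choose2-pl (γ λ′ s s² k)
                ℚ.- λ′ ℚ.* (λ′ ℚ.- 1ℚ) ℚ.* s² ℚ.* (k ℚ.* (k ℚ.- 1ℚ) ℚ.* ½)

  Lbound≡L : ∀ s N k → Lbound s N k ≡ L (lam s N) (ι s) (ι (s ℕ.* s)) (ι k)
  Lbound≡L s N k = refl

  L≡twiceL : ∀ λ′ s k g → λ′ ℚ.* (s ℚ.* s) ℚ.- 1ℚ ≢ 0ℚ →
             ιℤ g ℚ.≤ γ λ′ s (s ℚ.* s) k → γ λ′ s (s ℚ.* s) k ℚ.≤ ιℤ (ℤ.suc g) →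
             L λ′ s (s ℚ.* s) k ≡ twiceL ℚ.+-*-rawRing λ′ s k (ιℤ g) ℚ.* ½
  L≡twiceL λ′ s k g Y≢0 g≤γ γ≤suc[g] = begin
    L λ′ s (s ℚ.* s) k
      ≡⟨ cong (λ c → T ℚ.* Y ℚ.* c ℚ.- D) (choose2-pl-at g γ′ g≤γ γ≤suc[g]) ⟩
    T ℚ.* Y ℚ.* (choose2 g ℚ.+ ιℤ g ℚ.* (γ′ ℚ.- ιℤ g)) ℚ.- D
      ≡⟨ expand λ′ s k (ιℤ g) γ′ ⟩
    twiceL ℚ.+-*-rawRing λ′ s k (ιℤ g) ℚ.* ½ ℚ.+ T ℚ.* ιℤ g ℚ.* (γ′ ℚ.* Y ℚ.- X)
      ≡⟨ cong (λ z → twiceL ℚ.+-*-rawRing λ′ s k (ιℤ g) ℚ.* ½ ℚ.+ T ℚ.* ιℤ g ℚ.* (z ℚ.- X)) (÷′-*-cancel X Y Y≢0) ⟩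
    twiceL ℚ.+-*-rawRing λ′ s k (ιℤ g) ℚ.* ½ ℚ.+ T ℚ.* ιℤ g ℚ.* (X ℚ.- X)
      ≡⟨ vanish (twiceL ℚ.+-*-rawRing λ′ s k (ιℤ g) ℚ.* ½) (T ℚ.* ιℤ g) X ⟩
    twiceL ℚ.+-*-rawRing λ′ s k (ιℤ g) ℚ.* ½ ∎
    where
    open ≡-Reasoning
    open ℚ-Solver
    T Y X D γ′ : ℚ
    T = λ′ ℚ.* (s ℚ.* s)
    Y = λ′ ℚ.* (s ℚ.* s) ℚ.- 1ℚ
    X = (λ′ ℚ.* s ℚ.- 1ℚ) ℚ.* k
    D = λ′ ℚ.* (λ′ ℚ.- 1ℚ) ℚ.* (s ℚ.* s) ℚ.* (k ℚ.* (k ℚ.- 1ℚ) ℚ.* ½)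
    γ′ = γ λ′ s (s ℚ.* s) k
    expand : ∀ λ′ s k G γ →
      λ′ ℚ.* (s ℚ.* s) ℚ.* (λ′ ℚ.* (s ℚ.* s) ℚ.- 1ℚ) ℚ.* (G ℚ.* (G ℚ.- 1ℚ) ℚ.* ½ ℚ.+ G ℚ.* (γ ℚ.- G))
        ℚ.- λ′ ℚ.* (λ′ ℚ.- 1ℚ) ℚ.* (s ℚ.* s) ℚ.* (k ℚ.* (k ℚ.- 1ℚ) ℚ.* ½)
      ≡ twiceL ℚ.+-*-rawRing λ′ s k G ℚ.* ½
        ℚ.+ λ′ ℚ.* (s ℚ.* s) ℚ.* G ℚ.* (γ ℚ.* (λ′ ℚ.* (s ℚ.* s) ℚ.- 1ℚ) ℚ.- (λ′ ℚ.* s ℚ.- 1ℚ) ℚ.* k)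
    expand = solve 5 (λ λ′ s k G γ →
      λ′ :* (s :* s) :* (λ′ :* (s :* s) :- con 1ℚ) :* (G :* (G :- con 1ℚ) :* con ½ :+ G :* (γ :- G))
        :- λ′ :* (λ′ :- con 1ℚ) :* (s :* s) :* (k :* (k :- con 1ℚ) :* con ½)
      := twiceL (ℚ-syntax 5) λ′ s k G :* con ½
        :+ λ′ :* (s :* s) :* G :* (γ :* (λ′ :* (s :* s) :- con 1ℚ) :- (λ′ :* s :- con 1ℚ) :* k)) refl
    vanish : ∀ a b x → a ℚ.+ b ℚ.* (x ℚ.- x) ≡ a
    vanish = solve 3 (λ a b x → a :+ b :* (x :- x) := a) refl

  sumℚ-map-ιℤ : ∀ {X : Set} xs (f : X → ℚ) (g : X → ℤ) → (∀ x → f x ≡ ιℤ (g x)) →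
                sumℚ (map f xs) ≡ ιℤ (ListSums.∑ xs g)
  sumℚ-map-ιℤ []       f g f≡g = refl
  sumℚ-map-ιℤ (x ∷ xs) f g f≡g =
    trans (cong₂ ℚ._+_ (f≡g x) (sumℚ-map-ιℤ xs f g f≡g)) (sym (ιℤ-+ (g x) (ListSums.∑ xs g)))

  module Index (s N k l : ℕ) (1≤l : 1 ℕ.≤ l) (2≤s : 2 ℕ.≤ s) (λ≡l : lam s N ≡ ι l) where

    open import Data.Integer.Base using (_+_; _*_; _-_; _≤_; _<_)

    Yℤ Xℤ : ℤ
    Yℤ = + l * (+ s * + s) - 1ℤ
    Xℤ = (+ l * + s - 1ℤ) * + k

    γ′ : ℚ
    γ′ = γ (ι l) (ι s) (ι s ℚ.* ι s) (ι k)

    private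
      ιℤ-Y : ιℤ Yℤ ≡ ι l ℚ.* (ι s ℚ.* ι s) ℚ.- 1ℚ
      ιℤ-Y = ιℤ-⟦⟧ (‵ (+ l) ⊛ (‵ (+ s) ⊛ ‵ (+ s)) ⊕ ⊝ ‵ 1ℤ)

      ιℤ-X : ιℤ Xℤ ≡ (ι l ℚ.* ι s ℚ.- 1ℚ) ℚ.* ι k
      ιℤ-X = ιℤ-⟦⟧ ((‵ (+ l) ⊛ ‵ (+ s) ⊕ ⊝ ‵ 1ℤ) ⊛ ‵ (+ k))

      ιℤ[zY] : ∀ z → ιℤ (z * Yℤ) ≡ ιℤ z ℚ.* (ι l ℚ.* (ι s ℚ.* ι s) ℚ.- 1ℚ)
      ιℤ[zY] z = trans (ιℤ-* z Yℤ) (cong (ιℤ z ℚ.*_) ιℤ-Y)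

    0<Yℤ : 0ℤ < Yℤ
    0<Yℤ = subst (λ y → 0ℤ < y - 1ℤ) (trans (ℤ.pos-* l (s ℕ.* s)) (cong (+ l *_) (ℤ.pos-* s s)))
                 (0<j-i (ℤ.+<+ 1<ls²))
      where
      1<ls² : 1 ℕ.< l ℕ.* (s ℕ.* s)
      1<ls² = ℕ.<-≤-trans (ℕ.s≤s (ℕ.s≤s ℕ.z≤n)) (ℕ.*-mono-≤ 1≤l (ℕ.*-mono-≤ 2≤s 2≤s))

    0<Y : 0ℚ ℚ.< ι l ℚ.* (ι s ℚ.* ι s) ℚ.- 1ℚ
    0<Y = subst (0ℚ ℚ.<_) ιℤ-Y (ιℤ-mono-< 0<Yℤ)

    γ-lower : ∀ g → g * Yℤ ≤ Xℤ → ιℤ g ℚ.≤ γ′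
    γ-lower g gY≤X = ≤-÷′ 0<Y (subst₂ ℚ._≤_ (ιℤ[zY] g) ιℤ-X (ιℤ-mono-≤ gY≤X))

    γ-upper : ∀ g → Xℤ ≤ g * Yℤ → γ′ ℚ.≤ ιℤ g
    γ-upper g X≤gY = ÷′-≤ 0<Y (subst₂ ℚ._≤_ ιℤ-X (ιℤ[zY] g) (ιℤ-mono-≤ X≤gY))

    γ-upper-< : ∀ g → Xℤ < g * Yℤ → γ′ ℚ.< ιℤ g
    γ-upper-< g X<gY = ÷′-< 0<Y (subst₂ ℚ._<_ ιℤ-X (ιℤ[zY] g) (ιℤ-mono-< X<gY))

    Lbound≡twoL : ∀ g → ιℤ g ℚ.≤ γ′ → γ′ ℚ.≤ ιℤ (ℤ.suc g) → Lbound s N k ≡ ιℤ (twoL (+ l) (+ s) (+ k) g) ℚ.* ½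
    Lbound≡twoL g g≤γ γ≤suc[g] = begin
      Lbound s N k                                  ≡⟨ Lbound≡L s N k ⟩
      L (lam s N) (ι s) (ι (s ℕ.* s)) (ι k)         ≡⟨ cong₂ (λ λ′ s² → L λ′ (ι s) s² (ι k)) λ≡l (ι-* s s) ⟩
      L (ι l) (ι s) (ι s ℚ.* ι s) (ι k)
        ≡⟨ L≡twiceL (ι l) (ι s) (ι k) g (λ Y≡0 → ℚ.<-irrefl (sym Y≡0) 0<Y) g≤γ γ≤suc[g] ⟩
      twiceL ℚ.+-*-rawRing (ι l) (ι s) (ι k) (ιℤ g) ℚ.* ½ ≡⟨ cong (ℚ._* ½) (sym (ιℤ-twoL (+ l) (+ s) (+ k) g)) ⟩
      ιℤ (twoL (+ l) (+ s) (+ k) g) ℚ.* ½           ∎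
      where open ≡-Reasoning

    0≤⌊γ⌋ : 0ℤ ≤ floor γ′
    0≤⌊γ⌋ = floor-greatest (γ-lower 0ℤ (*-nonNeg (ℤ.i≤j⇒0≤j-i 1≤ls) (ℤ.+≤+ ℕ.z≤n)))
      where
      1≤ls : 1ℤ ≤ + l * + s
      1≤ls = subst (1ℤ ≤_) (ℤ.pos-* l s) (ℤ.+≤+ (ℕ.*-mono-≤ 1≤l (ℕ.≤-trans (ℕ.s≤s ℕ.z≤n) 2≤s)))

    Lbound≡twoL-floor : Lbound s N k ≡ ιℤ (twoL (+ l) (+ s) (+ k) (floor γ′)) ℚ.* ½
    Lbound≡twoL-floor = Lbound≡twoL (floor γ′) (floor-≤ γ′) (ℚ.<⇒≤ (<-suc-floor γ′))

  Unb22≡unbalance : ∀ {N k s} (A : Array N k s) l → lam s N ≡ ιℤ l → Unb22 A ≡ ιℤ (Unbalance.unbalance A l)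
  Unb22≡unbalance {N} {k} {s} A l λ≡l =
    sumℚ-map-ιℤ (points s) _ _ (λ x → sumℚ-map-ιℤ (pairs< k) _ _ (λ j → squared-deviation (count A x j)))
    where
    squared-deviation : ∀ c → (ι c ℚ.- lam s N) ℚ.* (ι c ℚ.- lam s N) ≡ ιℤ ((+ c ℤ.- l) ℤ.* (+ c ℤ.- l))
    squared-deviation c = trans (cong (λ q → (ι c ℚ.- q) ℚ.* (ι c ℚ.- q)) λ≡l)
                                (sym (ιℤ-⟦⟧ ((‵ (+ c) ⊕ ⊝ ‵ l) ⊛ (‵ (+ c) ⊕ ⊝ ‵ l))))

  N≡ls² : ∀ {s N l} → 1 ℕ.≤ s → lam s N ≡ ι l → + N ≡ + l ℤ.* (+ s ℤ.* + s)
  N≡ls² {s@(suc _)} {N} {l} _ λ≡l = trans (ιℤ-injective (begin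
      ι N                            ≡⟨ sym (÷′-*-cancel (ι N) (ι (s ℕ.* s)) s²≢0) ⟩
      lam s N ℚ.* ι (s ℕ.* s)        ≡⟨ cong (ℚ._* ι (s ℕ.* s)) λ≡l ⟩
      ι l ℚ.* ι (s ℕ.* s)            ≡⟨ sym (ιℤ-* (+ l) (+ (s ℕ.* s))) ⟩
      ιℤ (+ l ℤ.* + (s ℕ.* s))       ∎))
    (cong (+ l ℤ.*_) (ℤ.pos-* s s))
    where
    open ≡-Reasoning
    s²≢0 : ι (s ℕ.* s) ≢ 0ℚ
    s²≢0 s²≡0 with ιℤ-injective {+ (s ℕ.* s)} {0ℤ} s²≡0
    ... | ()

  Lbound≤Unb22 : ∀ {N k s} (A : Array N k s) l → 1 ℕ.≤ l → 2 ℕ.≤ s → lam s N ≡ ι l → Lbound s N k ℚ.≤ Unb22 A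
  Lbound≤Unb22 {N} {k} {s} A l 1≤l 2≤s λ≡l = begin
    Lbound s N k                                    ≡⟨ Lbound≡twoL-floor ⟩
    ιℤ (twoL (+ l) (+ s) (+ k) (floor γ′)) ℚ.* ½
      ≤⟨ ℚ.*-monoʳ-≤-nonNeg ½ (ιℤ-mono-≤ (twoL≤twice-unbalance (+ l) (floor γ′) N≡ls²′ 0≤⌊γ⌋)) ⟩
    ιℤ (+ 2 ℤ.* unbalance (+ l)) ℚ.* ½              ≡⟨ halve (unbalance (+ l)) ⟩
    ιℤ (unbalance (+ l))                            ≡⟨ sym (Unb22≡unbalance A (+ l) λ≡l) ⟩
    Unb22 A                                         ∎
    where
    open Index s N k l 1≤l 2≤s λ≡l
    open Unbalance A
    open ℚ.≤-Reasoning
    N≡ls²′ : + N ≡ + l ℤ.* (+ s ℤ.* + s)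
    N≡ls²′ = N≡ls² {s} {N} {l} (ℕ.≤-trans (ℕ.s≤s ℕ.z≤n) 2≤s) λ≡l
    halve : ∀ u → ιℤ (+ 2 ℤ.* u) ℚ.* ½ ≡ ιℤ u
    halve u = trans (cong (ℚ._* ½) (ιℤ-* (+ 2) u)) (twice-half (ιℤ u))
      where
      open ℚ-Solver
      twice-half : ∀ x → ι 2 ℚ.* x ℚ.* ½ ≡ x
      twice-half = solve 1 (λ x → con (ι 2) :* x :* con ½ := x) refl

module Index1 where

  open import Data.Integer.Base using (_+_; _*_; _-_; _≤_)
  open IntegerOrder
  open LowerBound
  open Polynomials using (Expr-rawRing; ‵_; _⊕_; _⊛_; ιℤ-⟦⟧)

  Lbound-index1 : ∀ s N k α κ → 2 ℕ.≤ s → lam s N ≡ 1ℚ → k ≡ α ℕ.* (s ℕ.+ 1) ℕ.+ κ → κ ℕ.≤ s →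
    Lbound s N k ≡ ι α ℚ.* ι κ ℚ.* ι s ℚ.* ι s ℚ.* (ι s ℚ.- 1ℚ) ℚ.+ choose2 (+ α) ℚ.* ι s ℚ.* ι s ℚ.* (ι s ℚ.* ι s ℚ.- 1ℚ)
  Lbound-index1 s N .(α ℕ.* (s ℕ.+ 1) ℕ.+ κ) α κ 2≤s λ≡1 refl κ≤s = begin
    Lbound s N k
      ≡⟨ Lbound≡twoL (+ α) (γ-lower (+ α) lower) (γ-upper (ℤ.suc (+ α)) upper) ⟩
    ιℤ (twoL (+ 1) (+ s) (+ k) (+ α)) ℚ.* ½
      ≡⟨ cong (λ k′ → ιℤ (twoL (+ 1) (+ s) k′ (+ α)) ℚ.* ½) +k≡ ⟩
    ιℤ (twoL (+ 1) (+ s) (+ α * (+ s + 1ℤ) + + κ) (+ α)) ℚ.* ½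
      ≡⟨ cong (ℚ._* ½) (ιℤ-⟦⟧ (twiceL Expr-rawRing (‵ (+ 1)) (‵ (+ s)) (‵ (+ α) ⊛ (‵ (+ s) ⊕ ‵ 1ℤ) ⊕ ‵ (+ κ)) (‵ (+ α)))) ⟩
    twiceL ℚ.+-*-rawRing 1ℚ (ι s) (ι α ℚ.* (ι s ℚ.+ 1ℚ) ℚ.+ ι κ) (ι α) ℚ.* ½
      ≡⟨ evaluate (ι s) (ι α) (ι κ) ⟩
    ι α ℚ.* ι κ ℚ.* ι s ℚ.* ι s ℚ.* (ι s ℚ.- 1ℚ) ℚ.+ choose2 (+ α) ℚ.* ι s ℚ.* ι s ℚ.* (ι s ℚ.* ι s ℚ.- 1ℚ) ∎
    where
    k : ℕ
    k = α ℕ.* (s ℕ.+ 1) ℕ.+ κ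
    open Index s N k 1 (ℕ.s≤s ℕ.z≤n) 2≤s λ≡1
    open ≡-Reasoning
    S A K : ℤ
    S = + s
    A = + α
    K = + κ
    +k≡ : + k ≡ A * (S + 1ℤ) + K
    +k≡ = cong (_+ K) (ℤ.pos-* α (s ℕ.+ 1))
    0≤S-1 : 0ℤ ≤ S - 1ℤ
    0≤S-1 = ℤ.i≤j⇒0≤j-i (ℤ.+≤+ (ℕ.≤-trans (ℕ.s≤s ℕ.z≤n) 2≤s))
    lower : A * Yℤ ≤ Xℤ
    lower = ≤-by-difference ((S - 1ℤ) * K)
              (trans (cong (λ k′ → (+ 1 * S - 1ℤ) * k′ - A * Yℤ) +k≡) (identity S A K))
              (*-nonNeg 0≤S-1 (ℤ.+≤+ ℕ.z≤n))
      where identity : ∀ S A K → (+ 1 * S - 1ℤ) * (A * (S + 1ℤ) + K) - A * (+ 1 * (S * S) - 1ℤ) ≡ (S - 1ℤ) * K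
            identity = solve-∀
    upper : Xℤ ≤ ℤ.suc A * Yℤ
    upper = ≤-by-difference ((S - 1ℤ) * (S + 1ℤ - K))
              (trans (cong (λ k′ → ℤ.suc A * Yℤ - (+ 1 * S - 1ℤ) * k′) +k≡) (identity S A K))
              (*-nonNeg 0≤S-1 (ℤ.i≤j⇒0≤j-i (ℤ.+≤+ (ℕ.≤-trans κ≤s (ℕ.m≤m+n s 1)))))
      where identity : ∀ S A K → (1ℤ + A) * (+ 1 * (S * S) - 1ℤ) - (+ 1 * S - 1ℤ) * (A * (S + 1ℤ) + K)
                              ≡ (S - 1ℤ) * (S + 1ℤ - K)
            identity = solve-∀
    evaluate : ∀ S A K → twiceL ℚ.+-*-rawRing 1ℚ S (A ℚ.* (S ℚ.+ 1ℚ) ℚ.+ K) A ℚ.* ½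
               ≡ A ℚ.* K ℚ.* S ℚ.* S ℚ.* (S ℚ.- 1ℚ) ℚ.+ A ℚ.* (A ℚ.- 1ℚ) ℚ.* ½ ℚ.* S ℚ.* S ℚ.* (S ℚ.* S ℚ.- 1ℚ)
    evaluate = solve 3 (λ S A K → twiceL (ℚ-syntax 3) (con 1ℚ) S (A :* (S :+ con 1ℚ) :+ K) A :* con ½
                              := A :* K :* S :* S :* (S :- con 1ℚ) :+ A :* (A :- con 1ℚ) :* con ½ :* S :* S :* (S :* S :- con 1ℚ)) refl
      where open ℚ-Solver

  E-α≡0 : ∀ α κ s → α ≡ 0 →
    ι α ℚ.* ι κ ℚ.* ι s ℚ.* ι s ℚ.* (ι s ℚ.- 1ℚ) ℚ.+ choose2 (+ α) ℚ.* ι s ℚ.* ι s ℚ.* (ι s ℚ.* ι s ℚ.- 1ℚ) ≡ 0ℚ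
  E-α≡0 .0 κ s refl = solve 2 (λ K S → con 0ℚ :* K :* S :* S :* (S :- con 1ℚ) :+ con 0ℚ :* (con 0ℚ :- con 1ℚ) :* con ½ :* S :* S :* (S :* S :- con 1ℚ)
                                  := con 0ℚ) refl (ι κ) (ι s)
    where open ℚ-Solver

  E-α≡1 : ∀ α κ s → α ≡ 1 →
    ι α ℚ.* ι κ ℚ.* ι s ℚ.* ι s ℚ.* (ι s ℚ.- 1ℚ) ℚ.+ choose2 (+ α) ℚ.* ι s ℚ.* ι s ℚ.* (ι s ℚ.* ι s ℚ.- 1ℚ) ≡ ι κ ℚ.* ι s ℚ.* ι s ℚ.* (ι s ℚ.- 1ℚ)
  E-α≡1 .1 κ s refl = solve 2 (λ K S → con 1ℚ :* K :* S :* S :* (S :- con 1ℚ) :+ con 1ℚ :* (con 1ℚ :- con 1ℚ) :* con ½ :* S :* S :* (S :* S :- con 1ℚ)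
                                  := K :* S :* S :* (S :- con 1ℚ)) refl (ι κ) (ι s)
    where open ℚ-Solver

module Index2 where

  open import Data.Integer.Base using (_+_; _*_; _-_; -_; _≤_; _<_)
  open RationalEmbedding
  open Floor
  open IntegerOrder
  open LowerBound
  open Polynomials using (Expr-rawRing; ‵_; _⊕_; _⊛_; ιℤ-⟦⟧)

  private
    0≤2s-1 : ∀ {s} → 2 ℕ.≤ s → 0ℤ ≤ + 2 * + s - 1ℤ
    0≤2s-1 {s} 2≤s =
      ℤ.i≤j⇒0≤j-i (subst (1ℤ ≤_) (ℤ.pos-* 2 s) (ℤ.+≤+ (ℕ.≤-trans (ℕ.≤-trans (ℕ.s≤s ℕ.z≤n) 2≤s) (ℕ.m≤n*m s 2))))

  Lbound-index2 : ∀ s N k κ → 2 ℕ.≤ s → lam s N ≡ ι 2 → k ≡ 2 ℕ.* s ℕ.+ 1 ℕ.+ κ → κ ℕ.≤ s →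
    Lbound s N k ≡ ι 2 ℚ.* ι s ℚ.* ι s ℚ.* ((ι 2 ℚ.* ι κ ℚ.- 1ℚ) ℚ.* (ι s ℚ.- 1ℚ) ℚ.- choose2 (+ (κ ℕ.+ 1)))
  Lbound-index2 s N .(2 ℕ.* s ℕ.+ 1 ℕ.+ κ) κ 2≤s λ≡2 refl κ≤s = begin
    Lbound s N k
      ≡⟨ Lbound≡twoL (+ 2) (γ-lower (+ 2) lower) (γ-upper (ℤ.suc (+ 2)) upper) ⟩
    ιℤ (twoL (+ 2) S (+ k) (+ 2)) ℚ.* ½
      ≡⟨ cong (λ k′ → ιℤ (twoL (+ 2) S k′ (+ 2)) ℚ.* ½) +k≡ ⟩
    ιℤ (twoL (+ 2) S (+ 2 * S + 1ℤ + K) (+ 2)) ℚ.* ½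
      ≡⟨ cong (ℚ._* ½) (ιℤ-⟦⟧ (twiceL Expr-rawRing (‵ (+ 2)) (‵ S) (‵ (+ 2) ⊛ ‵ S ⊕ ‵ 1ℤ ⊕ ‵ K) (‵ (+ 2)))) ⟩
    twiceL ℚ.+-*-rawRing (ι 2) (ι s) (ι 2 ℚ.* ι s ℚ.+ 1ℚ ℚ.+ ι κ) (ι 2) ℚ.* ½
      ≡⟨ evaluate (ι s) (ι κ) ⟩
    ι 2 ℚ.* ι s ℚ.* ι s ℚ.* ((ι 2 ℚ.* ι κ ℚ.- 1ℚ) ℚ.* (ι s ℚ.- 1ℚ) ℚ.- (ι κ ℚ.+ 1ℚ) ℚ.* ((ι κ ℚ.+ 1ℚ) ℚ.- 1ℚ) ℚ.* ½)
      ≡⟨ cong (λ t → ι 2 ℚ.* ι s ℚ.* ι s ℚ.* ((ι 2 ℚ.* ι κ ℚ.- 1ℚ) ℚ.* (ι s ℚ.- 1ℚ) ℚ.- t ℚ.* (t ℚ.- 1ℚ) ℚ.* ½))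
              (sym (ιℤ-+ (+ κ) 1ℤ)) ⟩
    ι 2 ℚ.* ι s ℚ.* ι s ℚ.* ((ι 2 ℚ.* ι κ ℚ.- 1ℚ) ℚ.* (ι s ℚ.- 1ℚ) ℚ.- choose2 (+ (κ ℕ.+ 1))) ∎
    where
    k : ℕ
    k = 2 ℕ.* s ℕ.+ 1 ℕ.+ κ
    open Index s N k 2 (ℕ.s≤s ℕ.z≤n) 2≤s λ≡2
    open ≡-Reasoning
    S K : ℤ
    S = + s
    K = + κ
    +k≡ : + k ≡ + 2 * S + 1ℤ + K
    +k≡ = cong (λ t → t + 1ℤ + K) (ℤ.pos-* 2 s)
    0≤2S-1 : 0ℤ ≤ + 2 * S - 1ℤ
    0≤2S-1 = 0≤2s-1 2≤s
    lower : + 2 * Yℤ ≤ Xℤ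
    lower = ≤-by-difference ((+ 2 * S - 1ℤ) * K + 1ℤ)
              (trans (cong (λ k′ → (+ 2 * S - 1ℤ) * k′ - + 2 * Yℤ) +k≡) (identity S K))
              (ℤ.+-mono-≤ (*-nonNeg 0≤2S-1 (ℤ.+≤+ ℕ.z≤n)) (ℤ.+≤+ ℕ.z≤n))
      where identity : ∀ S K → (+ 2 * S - 1ℤ) * (+ 2 * S + 1ℤ + K) - + 2 * (+ 2 * (S * S) - 1ℤ)
                              ≡ (+ 2 * S - 1ℤ) * K + 1ℤ
            identity = solve-∀
    upper : Xℤ ≤ ℤ.suc (+ 2) * Yℤ
    upper = ≤-by-difference ((+ 2 * S - 1ℤ) * (S - K) + (S - + 2))
              (trans (cong (λ k′ → ℤ.suc (+ 2) * Yℤ - (+ 2 * S - 1ℤ) * k′) +k≡) (identity S K))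
              (ℤ.+-mono-≤ (*-nonNeg 0≤2S-1 (ℤ.i≤j⇒0≤j-i (ℤ.+≤+ κ≤s))) (ℤ.i≤j⇒0≤j-i (ℤ.+≤+ 2≤s)))
      where identity : ∀ S K → (1ℤ + + 2) * (+ 2 * (S * S) - 1ℤ) - (+ 2 * S - 1ℤ) * (+ 2 * S + 1ℤ + K)
                              ≡ (+ 2 * S - 1ℤ) * (S - K) + (S - + 2)
            identity = solve-∀
    evaluate : ∀ S K → twiceL ℚ.+-*-rawRing (ι 2) S (ι 2 ℚ.* S ℚ.+ 1ℚ ℚ.+ K) (ι 2) ℚ.* ½
               ≡ ι 2 ℚ.* S ℚ.* S ℚ.* ((ι 2 ℚ.* K ℚ.- 1ℚ) ℚ.* (S ℚ.- 1ℚ) ℚ.- (K ℚ.+ 1ℚ) ℚ.* ((K ℚ.+ 1ℚ) ℚ.- 1ℚ) ℚ.* ½)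
    evaluate = solve 2 (λ S K → twiceL (ℚ-syntax 2) (con (ι 2)) S (con (ι 2) :* S :+ con 1ℚ :+ K) (con (ι 2)) :* con ½
                              := con (ι 2) :* S :* S :* ((con (ι 2) :* K :- con 1ℚ) :* (S :- con 1ℚ) :- (K :+ con 1ℚ) :* ((K :+ con 1ℚ) :- con 1ℚ) :* con ½)) refl
      where open ℚ-Solver

  module _ {s k : ℕ} (2≤s : 2 ℕ.≤ s) (2≤k : 2 ℕ.≤ k) (k≤2s+1 : k ℕ.≤ 2 ℕ.* s ℕ.+ 1) where

    private
      open ℤ-Solver
      S K : ℤ
      S = + s
      K = + k

      0<2S² : 0ℤ < + 2 * (S * S)
      0<2S² = *-pos {+ 2} (ℤ.+<+ (ℕ.s≤s ℕ.z≤n)) (*-pos 0<S 0<S)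
        where
        0<S : 0ℤ < S
        0<S = ℤ.+<+ (ℕ.≤-trans (ℕ.s≤s ℕ.z≤n) 2≤s)

      0<2[S-1] : 0ℤ < + 2 * (S - 1ℤ)
      0<2[S-1] = *-pos {+ 2} (ℤ.+<+ (ℕ.s≤s ℕ.z≤n)) (0<j-i (ℤ.+<+ 2≤s))

      negative : ∀ {t} d → t ≡ - (+ 2 * (S * S) * d) → 0ℤ < d → t < 0ℤ
      negative d t≡ 0<d = subst (_< 0ℤ) (sym t≡) (ℤ.neg-mono-< (*-pos 0<2S² 0<d))

    twoL-index2-at-0 : twoL (+ 2) S K 0ℤ < 0ℤ
    twoL-index2-at-0 = negative (K * (K - 1ℤ)) (identity S K) (*-pos 0<K (0<j-i (ℤ.+<+ 2≤k)))
      where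
      0<K : 0ℤ < K
      0<K = ℤ.+<+ (ℕ.≤-trans (ℕ.s≤s ℕ.z≤n) 2≤k)
      identity : ∀ S K → twoL (+ 2) S K 0ℤ ≡ - (+ 2 * (S * S) * (K * (K - 1ℤ)))
      identity = solve 2 (λ S K → twiceL (ℤ-syntax 2) (con (+ 2)) S K (con 0ℤ)
                                := :- (con (+ 2) :* (S :* S) :* (K :* (K :- con 1ℤ)))) refl

    twoL-index2-at-1 : twoL (+ 2) S K 1ℤ < 0ℤ
    twoL-index2-at-1 = negative (z * (z - 1ℤ) + + 2 * (S - 1ℤ)) (identity S K)
                                (ℤ.+-mono-≤-< (consecutive-product-nonNeg z) 0<2[S-1])
      where
      z : ℤ
      z = K - + 2 * S + 1ℤ
      identity : ∀ S K → twoL (+ 2) S K 1ℤ ≡ - (+ 2 * (S * S) *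
                   ((K - + 2 * S + 1ℤ) * (K - + 2 * S + 1ℤ - 1ℤ) + + 2 * (S - 1ℤ)))
      identity = solve 2 (λ S K → twiceL (ℤ-syntax 2) (con (+ 2)) S K (con 1ℤ)
                                := :- (con (+ 2) :* (S :* S) :*
                                   ((K :- con (+ 2) :* S :+ con 1ℤ) :* (K :- con (+ 2) :* S :+ con 1ℤ :- con 1ℤ) :+ con (+ 2) :* (S :- con 1ℤ)))) refl

    twoL-index2-at-2 : twoL (+ 2) S K (+ 2) < 0ℤ
    twoL-index2-at-2 = negative (a * (a + + 4 * (S - + 2) + + 3) + + 2 * (S - 1ℤ)) (identity S K)
                                (ℤ.+-mono-≤-< (*-nonNeg 0≤a 0≤a+4[S-2]+3) 0<2[S-1])
      where
      a : ℤ
      a = + 2 * S + 1ℤ - K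
      0≤a : 0ℤ ≤ a
      0≤a = ℤ.i≤j⇒0≤j-i (subst (λ t → K ≤ t + 1ℤ) (ℤ.pos-* 2 s) (ℤ.+≤+ k≤2s+1))
      0≤a+4[S-2]+3 : 0ℤ ≤ a + + 4 * (S - + 2) + + 3
      0≤a+4[S-2]+3 = ℤ.+-mono-≤ (ℤ.+-mono-≤ 0≤a (*-nonNeg {+ 4} (ℤ.+≤+ ℕ.z≤n) (ℤ.i≤j⇒0≤j-i (ℤ.+≤+ 2≤s)))) (ℤ.+≤+ ℕ.z≤n)
      identity : ∀ S K → twoL (+ 2) S K (+ 2) ≡ - (+ 2 * (S * S) *
                   ((+ 2 * S + 1ℤ - K) * ((+ 2 * S + 1ℤ - K) + + 4 * (S - + 2) + + 3) + + 2 * (S - 1ℤ)))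
      identity = solve 2 (λ S K → twiceL (ℤ-syntax 2) (con (+ 2)) S K (con (+ 2))
                                := :- (con (+ 2) :* (S :* S) :*
                                   ((con (+ 2) :* S :+ con 1ℤ :- K) :* ((con (+ 2) :* S :+ con 1ℤ :- K) :+ con (+ 4) :* (S :- con (+ 2)) :+ con (+ 3))
                                    :+ con (+ 2) :* (S :- con 1ℤ)))) refl

    twoL-index2-negative : ∀ g → 0ℤ ≤ g → g < + 3 → twoL (+ 2) S K g < 0ℤ
    twoL-index2-negative (+ 0) _ _ = twoL-index2-at-0
    twoL-index2-negative (+ 1) _ _ = twoL-index2-at-1
    twoL-index2-negative (+ 2) _ _ = twoL-index2-at-2
    twoL-index2-negative (+ suc (suc (suc _))) _ (ℤ.+<+ (ℕ.s≤s (ℕ.s≤s (ℕ.s≤s ()))))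

  Lbound-index2-negative : ∀ s N k → 2 ℕ.≤ s → lam s N ≡ ι 2 → 2 ℕ.≤ k → k ℕ.≤ 2 ℕ.* s ℕ.+ 1 → Lbound s N k ℚ.< 0ℚ
  Lbound-index2-negative s N k 2≤s λ≡2 2≤k k≤2s+1 = begin-strict
    Lbound s N k                                  ≡⟨ Lbound≡twoL-floor ⟩
    ιℤ (twoL (+ 2) (+ s) (+ k) (floor γ′)) ℚ.* ½
      <⟨ ℚ.*-monoˡ-<-pos ½ (ιℤ-mono-< (twoL-index2-negative 2≤s 2≤k k≤2s+1 (floor γ′) 0≤⌊γ⌋ ⌊γ⌋<3)) ⟩
    0ℚ                                            ∎
    where
    open Index s N k 2 (ℕ.s≤s ℕ.z≤n) 2≤s λ≡2
    open ℚ.≤-Reasoning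
    S K : ℤ
    S = + s
    K = + k
    X<3Y : Xℤ < + 3 * Yℤ
    X<3Y = <-by-difference ((+ 2 * S - 1ℤ) * (+ 2 * S + 1ℤ - K) + + 2 * (S - 1ℤ) * (1ℤ + S)) (identity S K)
                (ℤ.+-mono-≤-< (*-nonNeg (0≤2s-1 2≤s) (ℤ.i≤j⇒0≤j-i (subst (λ t → K ≤ t + 1ℤ) (ℤ.pos-* 2 s) (ℤ.+≤+ k≤2s+1))))
                              (*-pos (*-pos {+ 2} (ℤ.+<+ (ℕ.s≤s ℕ.z≤n)) (0<j-i (ℤ.+<+ 2≤s))) (ℤ.+<+ (ℕ.s≤s ℕ.z≤n))))
      where identity : ∀ S K → + 3 * (+ 2 * (S * S) - 1ℤ) - (+ 2 * S - 1ℤ) * K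
                              ≡ (+ 2 * S - 1ℤ) * (+ 2 * S + 1ℤ - K) + + 2 * (S - 1ℤ) * (1ℤ + S)
            identity = solve-∀
    ⌊γ⌋<3 : floor γ′ < + 3
    ⌊γ⌋<3 = ιℤ-cancel-< (ℚ.≤-<-trans (floor-≤ γ′) (γ-upper-< (+ 3) X<3Y))

open Index1 using (Lbound-index1; E-α≡0; E-α≡1)
open Index2 using (Lbound-index2; Lbound-index2-negative)
open LowerBound using (Lbound≤Unb22)

corollary2p12 :
  (s N k : ℕ) (A : Array N k s) → 2 ℕ.≤ s →
  -- (i) λ = 1, k = α(s+1) + κ̃, 0 ≤ κ̃ ≤ s
  ((α κ : ℕ) → lam s N ≡ 1ℚ → k ≡ α ℕ.* (s ℕ.+ 1) ℕ.+ κ → κ ℕ.≤ s →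
    let E = ι α ℚ.* ι κ ℚ.* ι s ℚ.* ι s ℚ.* (ι s ℚ.- 1ℚ)
            ℚ.+ choose2 (+ α) ℚ.* ι s ℚ.* ι s ℚ.* (ι s ℚ.* ι s ℚ.- 1ℚ)
    in (Lbound s N k ≡ E)
       × (E ℚ.≤ Unb22 A)
       × (α ≡ 0 → E ≡ 0ℚ)
       × (α ≡ 1 → E ≡ ι κ ℚ.* ι s ℚ.* ι s ℚ.* (ι s ℚ.- 1ℚ)))
  -- (ii) λ = 2, k = 2s + 1 + κ̃, 1 ≤ κ̃ ≤ s
  × ((κ : ℕ) → lam s N ≡ ι 2 → k ≡ 2 ℕ.* s ℕ.+ 1 ℕ.+ κ → 1 ℕ.≤ κ → κ ℕ.≤ s →
    let E = ι 2 ℚ.* ι s ℚ.* ι s ℚ.*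
            ((ι 2 ℚ.* ι κ ℚ.- 1ℚ) ℚ.* (ι s ℚ.- 1ℚ) ℚ.- choose2 (+ (κ ℕ.+ 1)))
    in (Lbound s N k ≡ E) × (E ℚ.≤ Unb22 A))
  -- (iii) λ = 2, 2 ≤ k ≤ 2s + 1
  × (lam s N ≡ ι 2 → 2 ℕ.≤ k → k ℕ.≤ 2 ℕ.* s ℕ.+ 1 → Lbound s N k ℚ.< 0ℚ)
corollary2p12 s N k A 2≤s =
    (λ α κ λ≡1 k≡ κ≤s →
       let L≡E = Lbound-index1 s N k α κ 2≤s λ≡1 k≡ κ≤s
       in L≡E , subst (ℚ._≤ Unb22 A) L≡E (Lbound≤Unb22 A 1 ℕ.≤-refl 2≤s λ≡1) , E-α≡0 α κ s , E-α≡1 α κ s)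
  -- (ii) does not need 1 ≤ κ̃.
  , (λ κ λ≡2 k≡ _ κ≤s →
       let L≡E = Lbound-index2 s N k κ 2≤s λ≡2 k≡ κ≤s
       in L≡E , subst (ℚ._≤ Unb22 A) L≡E (Lbound≤Unb22 A 2 (ℕ.s≤s ℕ.z≤n) 2≤s λ≡2))
  , Lbound-index2-negative s N k 2≤s
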